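{- Let $(\Omega,a)$ be a binding signature with associated endofunctor $\Sigma$ on $\mathcal I$ and let $[\eta_V,\varphi_V]:V+\Sigma(TV)\to TV$ be an initial $(V+\Sigma)$-algebra. Then $TV$ carries a (canonical) affine substitution algebra structure: there are morphisms $\sigma:\delta(TV)\hat\otimes TV\to TV$ and $\nu:1\to\delta(TV)$ such that $(TV,\sigma,\nu)$ is an affine substitution algebra.
   Context: Let $\mathbb{I}$ be the category whose objects are the sets $\mathbf{n}=\{1,\dots,n\}$ ($n\in\mathbb{N}$) and whose morphisms are injections; strict monoidal with $\mathbf n\otimes\mathbf m=\mathbf{n+m}$ (elements of $\mathbf m$ after those of $\mathbf n$, morphisms blockwise), unit $\mathbf 0$; $s:\mathbf 2\to\mathbf 2$ the transposition and $w:\mathbf 0\to\mathbf 1$ the unique map. $\mathcal I=\mathbf{Set}^{\mathbb I}$. Day convolution $(X\hat\otimes Y)(\mathbf n)=\int^{\mathbf m_1,\mathbf m_2}X(\mathbf m_1)\times Y(\mathbf m_2)\times\mathbb I(\mathbf{m_1+m_2},\mathbf n)$, classes $[x,y,f]$; its unit $J=\mathbb I(\mathbf 0,-)$ is the terminal presheaf $1$, and it is a symmetric monoidal structure; associators suppressed, unitors $\lambda_X:1\hat\otimes X\to X$, $r_X:X\hat\otimes 1\to X$, symmetry $\gamma$. The first projection $\pi_1:X\hat\otimes Y\to X$ sends $[x,y,f]\mapsto X(f\circ\iota)(x)$, where $\iota:\mathbf m_1\to\mathbf{m_1+m_2}$ is the inclusion. $V=\mathbb I(\mathbf 1,-)$.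 $\delta:\mathcal I\to\mathcal I$, $\delta(X)(\mathbf n)=X(\mathbf{n+1})$, $\delta(X)(f)=X(f\otimes\mathrm{id}_{\mathbf 1})$. $\mathsf{swap}_X:\delta^2X\to\delta^2X$ has components $X(\mathrm{id}_{\mathbf n}\otimes s)$; $\mathsf{up}_X:X\to\delta X$ has components $X(\mathrm{id}_{\mathbf n}\otimes w)$. Left strength $\mathsf{str}'_{X,Y}:X\hat\otimes\delta Y\to\delta(X\hat\otimes Y)$, $[x,y,f]\mapsto[x,y,f\otimes\mathrm{id}_{\mathbf 1}]$; right strength $\mathsf{str}_{X,Y}:\delta X\hat\otimes Y\to\delta(X\hat\otimes Y)$, $[x,y,f]\mapsto[x,y,(f\otimes\mathrm{id}_{\mathbf 1})\circ\theta]$ ($x\in X(\mathbf{m_1+1})$, $y\in Y(\mathbf m_2)$), $\theta:\mathbf{m_1+1+m_2}\to\mathbf{m_1+m_2+1}$ the bijection fixing $1..m_1$, $m_1+1\mapsto m_1+m_2+1$, $m_1+1+i\mapsto m_1+i$. An affine substitution algebra is $(X,\sigma,\nu)$ with $\sigma:\delta X\hat\otimes X\to X$, $\nu:1\to\delta X$, such that (a) $\sigma\circ(\nu\hat\otimes\mathrm{id})=\lambda_X$; (b) $\delta(\sigma)\circ\mathsf{str}'_{\delta X,X}\circ(\mathrm{id}\hat\otimes\nu)=r_{\delta X}$; (c) $\sigma\circ(\mathrm{id}_{\delta X}\hat\otimes\sigma)=\sigma\circ(\delta\sigma\hat\otimes\mathrm{id})\circ(\mathsf{str}'_{\delta X,X}\hat\otimes\mathrm{id})$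 on $\delta X\hat\otimes\delta X\hat\otimes X$; (d) $\sigma\circ(\delta\sigma\hat\otimes\mathrm{id})\circ(\mathsf{str}_{\delta X,X}\hat\otimes\mathrm{id})=\sigma\circ(\delta\sigma\hat\otimes\mathrm{id})\circ(\mathsf{str}_{\delta X,X}\hat\otimes\mathrm{id})\circ(\mathrm{id}_{\delta^2X}\hat\otimes\gamma_{X,X})\circ(\mathsf{swap}_X\hat\otimes\mathrm{id}_{X\hat\otimes X})$ on $\delta^2X\hat\otimes X\hat\otimes X$; (e) $\sigma\circ(\mathsf{up}_X\hat\otimes\mathrm{id}_X)=\pi_1:X\hat\otimes X\to X$. A binding signature is a set $\Omega$ with $a:\Omega\to\mathbb N^*$; for $a(\omega)=(n_1,\dots,n_k)$, $\Sigma_\omega(X)=\delta^{n_1}X\hat\otimes\cdots\hat\otimes\delta^{n_k}X$ ($J$ if $k=0$) and $\Sigma(X)=\coprod_\omega\Sigma_\omega(X)$. -}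

module Defs where

open import Data.Nat using (ℕ; zero; suc; _+_)
open import Data.Nat.Properties using (+-assoc; +-identityʳ)
open import Data.Fin using (Fin; splitAt; join; cast; _↑ˡ_; _↑ʳ_)
open import Data.Fin.Properties using (splitAt-join; join-splitAt; cast-involutive; ↑ˡ-injective; ↑ʳ-injective)
open import Data.Sum using (_⊎_; inj₁; inj₂)
import Data.Sum as Sum
open import Data.Sum.Properties using (inj₁-injective; inj₂-injective)
open import Data.Product using (Σ; _,_; _×_; proj₁; proj₂)
open import Data.Unit using (⊤; tt)
open import Data.List using (List; []; _∷_)
open import Relation.Binary.PropositionalEquality
  using (_≡_; refl; sym; trans; cong; _≗_)
open import Relation.Binary.Structures using (IsEquivalence)
open import Relation.Binary.Construct.Closure.Equivalence as EqC using (EqClosure)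
open import Relation.Binary.Construct.Closure.Symmetric using (fwd; bwd)
open import Relation.Binary.Construct.Closure.ReflexiveTransitive using (ε; _◅_)

record Inj (m n : ℕ) : Set where
  constructor mkInj
  field
    fun : Fin m → Fin n
    inj : ∀ {i j} → fun i ≡ fun j → i ≡ j
open Inj public

_≈I_ : ∀ {m n} → Inj m n → Inj m n → Set
f ≈I g = fun f ≗ fun g

idI : ∀ {n} → Inj n n
idI = mkInj (λ i → i) (λ e → e)

infixr 9 _∘I_
_∘I_ : ∀ {l m n} → Inj m n → Inj l m → Inj l n
g ∘I f = mkInj (λ i → fun g (fun f i)) (λ e → inj f (inj g e))

⊗fun : ∀ {m n m' n'} → (Fin m → Fin n) → (Fin m' → Fin n') → Fin (m + m') → Fin (n + n')
⊗fun {m} {n} {m'} {n'} f g i = join n n' (Sum.map f g (splitAt m i))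

splitAt-inj : ∀ m {n} {i j : Fin (m + n)} → splitAt m i ≡ splitAt m j → i ≡ j
splitAt-inj m {n} {i} {j} e =
  trans (sym (join-splitAt m n i)) (trans (cong (join m n) e) (join-splitAt m n j))

join-inj : ∀ m n {a b : Fin m ⊎ Fin n} → join m n a ≡ join m n b → a ≡ b
join-inj m n {a} {b} e =
  trans (sym (splitAt-join m n a)) (trans (cong (splitAt m) e) (splitAt-join m n b))

map-inj : ∀ {m n m' n'} (f : Inj m n) (g : Inj m' n') {a b : Fin m ⊎ Fin m'} →
          Sum.map (fun f) (fun g) a ≡ Sum.map (fun f) (fun g) b → a ≡ b
map-inj f g {inj₁ x} {inj₁ y} e = cong inj₁ (inj f (inj₁-injective e))
map-inj f g {inj₁ x} {inj₂ y} ()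
map-inj f g {inj₂ x} {inj₁ y} ()
map-inj f g {inj₂ x} {inj₂ y} e = cong inj₂ (inj g (inj₂-injective e))

infixr 10 _⊗I_
_⊗I_ : ∀ {m n m' n'} → Inj m n → Inj m' n' → Inj (m + m') (n + n')
_⊗I_ {m} {n} {m'} {n'} f g =
  mkInj (⊗fun (fun f) (fun g)) (λ e → splitAt-inj m (map-inj f g (join-inj n n' e)))

castI : ∀ {m n} → m ≡ n → Inj m n
castI {m} {n} e = mkInj (cast e) (λ {i} {j} p →
  trans (sym (cast-involutive (sym e) e i))
        (trans (cong (cast (sym e)) p) (cast-involutive (sym e) e j)))

blockSwap : ∀ m k → Inj (m + k) (k + m)
blockSwap m k = mkInj (λ i → join k m (Sum.swap (splitAt m i)))
  (λ e → splitAt-inj m (swap-inj (join-inj k m e)))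
  where
  swap-inj : ∀ {a b : Fin m ⊎ Fin k} → Sum.swap a ≡ Sum.swap b → a ≡ b
  swap-inj {inj₁ x} {inj₁ y} e = cong inj₁ (inj₂-injective e)
  swap-inj {inj₁ x} {inj₂ y} ()
  swap-inj {inj₂ x} {inj₁ y} ()
  swap-inj {inj₂ x} {inj₂ y} e = cong inj₂ (inj₁-injective e)

inclL : ∀ {m} k → Inj m (m + k)
inclL k = mkInj (λ i → i ↑ˡ k) (λ {i} {j} e → ↑ˡ-injective k i j e)

inclR : ∀ m {k} → Inj k (m + k)
inclR m = mkInj (λ i → m ↑ʳ i) (λ {i} {j} e → ↑ʳ-injective m i j e)

s : Inj 2 2
s = blockSwap 1 1

w : Inj 0 1
w = mkInj (λ ()) (λ {i} → λ { {()} _ })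

-- Since Agda has no quotient types, each X(n) is a
-- setoid (the Day convolution coend is a quotient); a presheaf is a
-- functor to setoids, with functoriality up to the setoid equality.

record Psh : Set₁ where
  field
    Ob       : ℕ → Set
    Eq       : ∀ {n} → Ob n → Ob n → Set
    isEquiv  : ∀ {n} → IsEquivalence (Eq {n})
    act      : ∀ {m n} → Inj m n → Ob m → Ob n
    act-cong : ∀ {m n} {f g : Inj m n} {x y : Ob m} → f ≈I g → Eq x y → Eq (act f x) (act g y)
    act-id   : ∀ {n} (x : Ob n) → Eq (act idI x) x
    act-∘    : ∀ {l m n} (g : Inj m n) (f : Inj l m) (x : Ob l) →
               Eq (act (g ∘I f) x) (act g (act f x))
open Psh public

module _ (X : Psh) {n : ℕ} where
  ≈refl : ∀ {x : Ob X n} → Eq X x x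
  ≈refl = IsEquivalence.refl (isEquiv X)
  ≈trans : ∀ {x y z : Ob X n} → Eq X x y → Eq X y z → Eq X x z
  ≈trans = IsEquivalence.trans (isEquiv X)

Fun : Psh → Psh → Set
Fun X Y = ∀ {n} → Ob X n → Ob Y n

record Hom (X Y : Psh) : Set where
  field
    hom  : Fun X Y
    hom-cong : ∀ {n} {x y : Ob X n} → Eq X x y → Eq Y (hom x) (hom y)
    nat  : ∀ {m n} (f : Inj m n) (x : Ob X m) → Eq Y (hom (act X f x)) (act Y f (hom x))
open Hom public

⊗-cong : ∀ {m n m' n'} {f f' : Inj m n} {g g' : Inj m' n'} →
         f ≈I f' → g ≈I g' → (f ⊗I g) ≈I (f' ⊗I g')
⊗-cong {m} {n} {m'} {n'} p q i with splitAt m i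
... | inj₁ a = cong (join n n' ∘′ inj₁) (p a) where open import Function using (_∘′_)
... | inj₂ b = cong (join n n' ∘′ inj₂) (q b) where open import Function using (_∘′_)

⊗-id : ∀ {m m'} → (idI {m} ⊗I idI {m'}) ≈I idI
⊗-id {m} {m'} i = trans (cong (join m m') (lem (splitAt m i))) (join-splitAt m m' i)
  where
  lem : (a : Fin m ⊎ Fin m') → Sum.map (λ j → j) (λ j → j) a ≡ a
  lem (inj₁ _) = refl
  lem (inj₂ _) = refl

⊗-∘ : ∀ {m n o m' n' o'} (g : Inj n o) (f : Inj m n) (h : Inj n' o') (k : Inj m' n') →
      ((g ∘I f) ⊗I (h ∘I k)) ≈I ((g ⊗I h) ∘I (f ⊗I k))
⊗-∘ {m} {n} {o} {m'} {n'} {o'} g f h k i =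
  trans (cong (join o o') (lem (splitAt m i)))
        (sym (cong (λ z → join o o' (Sum.map (fun g) (fun h) z))
                   (splitAt-join n n' (Sum.map (fun f) (fun k) (splitAt m i)))))
  where
  lem : (a : Fin m ⊎ Fin m') →
        Sum.map (fun (g ∘I f)) (fun (h ∘I k)) a ≡ Sum.map (fun g) (fun h) (Sum.map (fun f) (fun k) a)
  lem (inj₁ _) = refl
  lem (inj₂ _) = refl

-- Terminal presheaf 1 (= J = 𝕀(0,-)), representable V = 𝕀(1,-)

One : Psh
One = record
  { Ob = λ _ → ⊤ ; Eq = λ _ _ → ⊤
  ; isEquiv = record { refl = tt ; sym = λ _ → tt ; trans = λ _ _ → tt }
  ; act = λ _ _ → tt ; act-cong = λ _ _ → tt ; act-id = λ _ → tt ; act-∘ = λ _ _ _ → tt }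

V : Psh
V = record
  { Ob = λ n → Inj 1 n
  ; Eq = λ f g → f ≈I g
  ; isEquiv = record { refl = λ _ → refl ; sym = λ p i → sym (p i) ; trans = λ p q i → trans (p i) (q i) }
  ; act = λ f g → f ∘I g
  ; act-cong = λ {_} {_} {f} {g} {x} {y} p q i → trans (cong (fun f) (q i)) (p (fun y i))
  ; act-id = λ _ _ → refl
  ; act-∘ = λ _ _ _ _ → refl }

δ : Psh → Psh
δ X = record
  { Ob = λ n → Ob X (n + 1)
  ; Eq = Eq X
  ; isEquiv = isEquiv X
  ; act = λ f → act X (f ⊗I idI {1})
  ; act-cong = λ {_} {_} {f} {g} p q → act-cong X {f = f ⊗I idI {1}} {g = g ⊗I idI {1}} (⊗-cong {f = f} {f' = g} {g = idI {1}} {g' = idI {1}} p (λ _ → refl)) q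
  ; act-id = λ x → ≈trans X (act-cong X (⊗-id {_} {1}) (≈refl X)) (act-id X x)
  ; act-∘ = λ g f x → ≈trans X (act-cong X (⊗-∘ g f idI idI) (≈refl X)) (act-∘ X _ _ x)
  }

δ^ : ℕ → Psh → Psh
δ^ zero X = X
δ^ (suc k) X = δ (δ^ k X)

δmap : ∀ {X Y} → Fun X Y → Fun (δ X) (δ Y)
δmap F {n} = F {n + 1}

δ^map : ∀ k {X Y} → Fun X Y → Fun (δ^ k X) (δ^ k Y)
δ^map zero F = F
δ^map (suc k) {X} {Y} F = δmap {δ^ k X} {δ^ k Y} (δ^map k F)

-- Day convolution: the coend presented as a setoid.

module _ (X Y : Psh) where

  data DayEl (n : ℕ) : Set where
    ⟦_,_,_⟧ : ∀ {m₁ m₂} → Ob X m₁ → Ob Y m₂ → Inj (m₁ + m₂) n → DayEl n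

  data DayGen {n : ℕ} : DayEl n → DayEl n → Set where
    coend : ∀ {m₁ m₁' m₂ m₂'} (g : Inj m₁ m₁') (h : Inj m₂ m₂') (x : Ob X m₁) (y : Ob Y m₂)
            (k : Inj (m₁' + m₂') n) (k' : Inj (m₁ + m₂) n) → k' ≈I (k ∘I (g ⊗I h)) →
            DayGen ⟦ act X g x , act Y h y , k ⟧ ⟦ x , y , k' ⟧
    resp  : ∀ {m₁ m₂} {x x' : Ob X m₁} {y y' : Ob Y m₂} {k k' : Inj (m₁ + m₂) n} →
            Eq X x x' → Eq Y y y' → k ≈I k' → DayGen ⟦ x , y , k ⟧ ⟦ x' , y' , k' ⟧

  dayAct : ∀ {m n} → Inj m n → DayEl m → DayEl n
  dayAct f ⟦ x , y , k ⟧ = ⟦ x , y , f ∘I k ⟧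

  private
    pres : ∀ {m n} (f : Inj m n) {a b : DayEl m} → DayGen a b → DayGen (dayAct f a) (dayAct f b)
    pres f (coend g h x y k k' p) = coend g h x y (f ∘I k) (f ∘I k') (λ i → Relation.Binary.PropositionalEquality.cong (fun f) (p i))
    pres f (resp p q r) = resp p q (λ i → Relation.Binary.PropositionalEquality.cong (fun f) (r i))

    post : ∀ {m n} {f f' : Inj m n} → f ≈I f' → (b : DayEl m) → DayGen (dayAct f b) (dayAct f' b)
    post p ⟦ x , y , k ⟧ = resp (≈refl X) (≈refl Y) (λ i → p (fun k i))

  Day : Psh
  Day = record
    { Ob = DayEl
    ; Eq = EqClosure DayGen
    ; isEquiv = EqC.isEquivalence DayGen
    ; act = dayAct
    ; act-cong = λ {_} {_} {f} {g} {x} {y} p q →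
        IsEquivalence.trans (EqC.isEquivalence DayGen)
          (EqC.gmap (dayAct f) (pres f) q) (fwd (post p y) ◅ ε)
    ; act-id = λ { ⟦ x , y , k ⟧ → fwd (resp (≈refl X) (≈refl Y) (λ _ → refl)) ◅ ε }
    ; act-∘ = λ { g f ⟦ x , y , k ⟧ → fwd (resp (≈refl X) (≈refl Y) (λ _ → refl)) ◅ ε }
    }

infixr 6 _⊗̂_
_⊗̂_ : Psh → Psh → Psh
X ⊗̂ Y = Day X Y

dayMap : ∀ {X X' Y Y'} → Fun X X' → Fun Y Y' → Fun (X ⊗̂ Y) (X' ⊗̂ Y')
dayMap F G ⟦ x , y , k ⟧ = ⟦ F x , G y , k ⟧

idF : ∀ X → Fun X X
idF X x = x

unitL : ∀ X → Fun (One ⊗̂ X) X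
unitL X (⟦_,_,_⟧ {m₁} _ x k) = act X (k ∘I inclR m₁) x

unitR : ∀ X → Fun (X ⊗̂ One) X
unitR X (⟦_,_,_⟧ {m₁} {m₂} x _ k) = act X (k ∘I inclL m₂) x

proj1 : ∀ X Y → Fun (X ⊗̂ Y) X
proj1 X Y (⟦_,_,_⟧ {m₁} {m₂} x y k) = act X (k ∘I inclL m₂) x

gamma : ∀ X Y → Fun (X ⊗̂ Y) (Y ⊗̂ X)
gamma X Y (⟦_,_,_⟧ {m₁} {m₂} x y k) = ⟦ y , x , k ∘I blockSwap m₂ m₁ ⟧

assocL : ∀ X Y Z → Fun (X ⊗̂ (Y ⊗̂ Z)) ((X ⊗̂ Y) ⊗̂ Z)
assocL X Y Z (⟦_,_,_⟧ {m₁} x (⟦_,_,_⟧ {m₂} {m₃} y z f) g) =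
  ⟦ ⟦ x , y , idI ⟧ , z , g ∘I (idI ⊗I f) ∘I castI (+-assoc m₁ m₂ m₃) ⟧

swapδ : ∀ X → Fun (δ (δ X)) (δ (δ X))
swapδ X {n} = act X (castI (sym (+-assoc n 1 1)) ∘I (idI {n} ⊗I s) ∘I castI (+-assoc n 1 1))

up : ∀ X → Fun X (δ X)
up X {n} = act X ((idI {n} ⊗I w) ∘I castI (sym (+-identityʳ n)))

strL : ∀ X Y → Fun (X ⊗̂ δ Y) (δ (X ⊗̂ Y))
strL X Y (⟦_,_,_⟧ {m₁} {m₂} x y f) = ⟦ x , y , (f ⊗I idI {1}) ∘I castI (sym (+-assoc m₁ m₂ 1)) ⟧

theta : ∀ m₁ m₂ → Inj ((m₁ + 1) + m₂) ((m₁ + m₂) + 1)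
theta m₁ m₂ = castI (sym (+-assoc m₁ m₂ 1)) ∘I (idI {m₁} ⊗I blockSwap 1 m₂) ∘I castI (+-assoc m₁ 1 m₂)

strR : ∀ X Y → Fun (δ X ⊗̂ Y) (δ (X ⊗̂ Y))
strR X Y (⟦_,_,_⟧ {m₁} {m₂} x y f) = ⟦ x , y , (f ⊗I idI {1}) ∘I theta m₁ m₂ ⟧

record IsAffineSubstAlg (X : Psh) (σ : Hom (δ X ⊗̂ X) X) (ν : Hom One (δ X)) : Set where
  field
    ax-a : ∀ {n} (e : Ob (One ⊗̂ X) n) →
           Eq X (hom σ (dayMap {One} {δ X} {X} {X} (hom ν) (idF X) e)) (unitL X e)
    ax-b : ∀ {n} (e : Ob (δ X ⊗̂ One) n) →
           Eq (δ X) (δmap {δ X ⊗̂ X} {X} (hom σ)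
                       (strL (δ X) X (dayMap {δ X} {δ X} {One} {δ X} (idF (δ X)) (hom ν) e)))
                    (unitR (δ X) e)
    ax-c : ∀ {n} (e : Ob (δ X ⊗̂ (δ X ⊗̂ X)) n) →
           Eq X (hom σ (dayMap {δ X} {δ X} {δ X ⊗̂ X} {X} (idF (δ X)) (hom σ) e))
                (hom σ (dayMap {δ (δ X ⊗̂ X)} {δ X} {X} {X} (δmap {δ X ⊗̂ X} {X} (hom σ)) (idF X)
                  (dayMap {δ X ⊗̂ δ X} {δ (δ X ⊗̂ X)} {X} {X} (strL (δ X) X) (idF X)
                    (assocL (δ X) (δ X) X e))))
    ax-d : ∀ {n} (e : Ob (δ (δ X) ⊗̂ (X ⊗̂ X)) n) →
           let L : Fun ((δ (δ X) ⊗̂ X) ⊗̂ X) X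
               L = λ t → hom σ (dayMap {δ (δ X ⊗̂ X)} {δ X} {X} {X} (δmap {δ X ⊗̂ X} {X} (hom σ)) (idF X)
                            (dayMap {δ (δ X) ⊗̂ X} {δ (δ X ⊗̂ X)} {X} {X} (strR (δ X) X) (idF X) t))
           in Eq X (L (assocL (δ (δ X)) X X e))
                   (L (assocL (δ (δ X)) X X
                        (dayMap {δ (δ X)} {δ (δ X)} {X ⊗̂ X} {X ⊗̂ X} (idF (δ (δ X))) (gamma X X)
                          (dayMap {δ (δ X)} {δ (δ X)} {X ⊗̂ X} {X ⊗̂ X} (swapδ X) (idF (X ⊗̂ X)) e))))
    ax-e : ∀ {n} (e : Ob (X ⊗̂ X) n) →
           Eq X (hom σ (dayMap {X} {δ X} {X} {X} (up X) (idF X) e)) (proj1 X X e)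

record BindingSignature : Set₁ where
  field
    Op : Set
    ar : Op → List ℕ
open BindingSignature public

SigProd : Psh → List ℕ → Psh
SigProd X [] = One
SigProd X (n ∷ []) = δ^ n X
SigProd X (n ∷ m ∷ ns) = δ^ n X ⊗̂ SigProd X (m ∷ ns)

sigProdMap : ∀ {X Y} (ns : List ℕ) → Fun X Y → Fun (SigProd X ns) (SigProd Y ns)
sigProdMap [] F t = t
sigProdMap (n ∷ []) F = δ^map n F
sigProdMap {X} {Y} (n ∷ m ∷ ns) F =
  dayMap {δ^ n X} {δ^ n Y} {SigProd X (m ∷ ns)} {SigProd Y (m ∷ ns)}
         (δ^map n F) (sigProdMap (m ∷ ns) F)

module _ (I : Set) (F : I → Psh) where
  data CoEq {n : ℕ} : Σ I (λ i → Ob (F i) n) → Σ I (λ i → Ob (F i) n) → Set where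
    coinj : ∀ {i} {x y : Ob (F i) n} → Eq (F i) x y → CoEq (i , x) (i , y)

  Coprod : Psh
  Coprod = record
    { Ob = λ n → Σ I (λ i → Ob (F i) n)
    ; Eq = CoEq
    ; isEquiv = record
        { refl = λ { {i , x} → coinj (≈refl (F i)) }
        ; sym = λ { (coinj {i} p) → coinj (IsEquivalence.sym (isEquiv (F i)) p) }
        ; trans = λ { (coinj {i} p) (coinj q) → coinj (≈trans (F i) p q) } }
    ; act = λ { f (i , x) → i , act (F i) f x }
    ; act-cong = λ { p (coinj {i} q) → coinj (act-cong (F i) p q) }
    ; act-id = λ { (i , x) → coinj (act-id (F i) x) }
    ; act-∘ = λ { g f (i , x) → coinj (act-∘ (F i) g f x) }
    }

SigF : BindingSignature → Psh → Psh
SigF S X = Coprod (Op S) (λ ω → SigProd X (ar S ω))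

sigMap : ∀ S {X Y} → Fun X Y → Fun (SigF S X) (SigF S Y)
sigMap S F (ω , t) = ω , sigProdMap (ar S ω) F t

module _ (S : BindingSignature) (T : Psh) (η : Hom V T) (φ : Hom (SigF S T) T) where

  IsAlgHom : (Z : Psh) (ζ : Hom V Z) (ψ : Hom (SigF S Z) Z) → Hom T Z → Set
  IsAlgHom Z ζ ψ h =
    (∀ {n} (v : Ob V n) → Eq Z (hom h (hom η v)) (hom ζ v)) ×
    (∀ {n} (t : Ob (SigF S T) n) → Eq Z (hom h (hom φ t)) (hom ψ (sigMap S (hom h) t)))

  IsInitialAlg : Set₁
  IsInitialAlg = (Z : Psh) (ζ : Hom V Z) (ψ : Hom (SigF S Z) Z) →
    Σ (Hom T Z) λ h → IsAlgHom Z ζ ψ h ×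
      ((h' : Hom T Z) → IsAlgHom Z ζ ψ h' → ∀ {n} (x : Ob T n) → Eq Z (hom h' x) (hom h x))

{-# OPTIONS --safe #-}
module Submission where

-- By initiality, T is isomorphic as a (V + Σ)-algebra to the presheaf of affine terms: terms over the
-- signature in which the arguments of an operation have pairwise disjoint free variables, acted on by
-- renaming along injections. The inverse of the initial map decodes an affine term by splitting its
-- context along the free variables of the arguments, which is what the Day convolution in Σ requires.
-- On affine terms σ substitutes a term for the last variable and ν is the last variable, so that the
-- axioms become the classical substitution lemmas: (a) substituting into the variable itself, (b)
-- substituting the variable for itself, (c) associativity of substitution, (d) exchange of two
-- independent substitutions and (e) substituting for a variable that does not occur. They transfer
-- to T along the isomorphism.

open import Data.Empty using (⊥; ⊥-elim)
import Data.Empty.Irrelevant as Irrelevant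
open import Data.Fin using (Fin; zero; suc; splitAt; join; cast; _↑ˡ_; _↑ʳ_; toℕ)
open import Data.Fin.Properties
  using (join-splitAt; splitAt-↑ˡ; splitAt-↑ʳ; ↑ˡ-injective;
         toℕ-injective; toℕ-↑ˡ; toℕ-↑ʳ; toℕ-cast; suc-injective; any?; _≟_)
open import Data.List using (List; []; _∷_)
open import Data.Nat using (ℕ; _+_)
open import Data.Nat.Properties using (+-assoc; +-identityʳ)
open import Data.Product using (Σ; ∃; _,_; _×_; proj₁; proj₂)
open import Data.Sum using (_⊎_; inj₁; inj₂; [_,_]′)
open import Data.Unit using (⊤; tt)
open import Data.Vec.Functional using (_++_)
open import Data.Vec.Functional.Properties using (lookup-++ˡ; lookup-++ʳ)
open import Function using (_∘_)
open import Relation.Binary.Construct.Closure.Equivalence using (gfold)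
open import Relation.Binary.Construct.Closure.ReflexiveTransitive using (ε; _◅_)
open import Relation.Binary.Construct.Closure.Symmetric using (fwd; bwd)
open import Relation.Binary.PropositionalEquality
  using (_≡_; _≢_; refl; sym; trans; cong; cong₂; subst; _≗_; isEquivalence; module ≡-Reasoning)
open import Relation.Binary.Structures using (IsEquivalence)
open import Relation.Nullary using (Dec; yes; no)
open import Relation.Nullary.Decidable using (_⊎-dec_)

open import Defs

↑-ind : ∀ {a b} (P : Fin (a + b) → Set) → (∀ x → P (x ↑ˡ b)) → (∀ y → P (a ↑ʳ y)) → ∀ i → P i
↑-ind {a} {b} P left right i = subst P (join-splitAt a b i) (by-cases (splitAt a i))
  where
  by-cases : (s : Fin a ⊎ Fin b) → P (join a b s)
  by-cases (inj₁ x) = left x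
  by-cases (inj₂ y) = right y

↑ˡ≢↑ʳ : ∀ {a b} (x : Fin a) (y : Fin b) → x ↑ˡ b ≢ a ↑ʳ y
↑ˡ≢↑ʳ {a} {b} x y e with trans (sym (splitAt-↑ˡ a x b)) (trans (cong (splitAt a) e) (splitAt-↑ʳ a b y))
... | ()

Fin1-≡ : (x y : Fin 1) → x ≡ y
Fin1-≡ zero zero = refl

⊗fun-↑ˡ : ∀ {m n m' n'} (f : Fin m → Fin n) (g : Fin m' → Fin n') x → ⊗fun f g (x ↑ˡ m') ≡ f x ↑ˡ n'
⊗fun-↑ˡ {m} {m' = m'} f g x rewrite splitAt-↑ˡ m x m' = refl

⊗fun-↑ʳ : ∀ {m n m' n'} (f : Fin m → Fin n) (g : Fin m' → Fin n') y → ⊗fun f g (m ↑ʳ y) ≡ n ↑ʳ g y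
⊗fun-↑ʳ {m} {m' = m'} f g y rewrite splitAt-↑ʳ m m' y = refl

blockSwap-↑ˡ : ∀ m k (x : Fin m) → fun (blockSwap m k) (x ↑ˡ k) ≡ k ↑ʳ x
blockSwap-↑ˡ m k x rewrite splitAt-↑ˡ m x k = refl

blockSwap-↑ʳ : ∀ m k (y : Fin k) → fun (blockSwap m k) (m ↑ʳ y) ≡ y ↑ˡ m
blockSwap-↑ʳ m k y rewrite splitAt-↑ʳ m k y = refl

cast-toℕ : ∀ {m n} .(e : m ≡ n) {i : Fin m} {j : Fin n} → toℕ i ≡ toℕ j → cast e i ≡ j
cast-toℕ e {i} p = toℕ-injective (trans (toℕ-cast e i) p)

module _ (m n p : ℕ) where

  toℕ-↑ˡ↑ˡ : (a : Fin m) → toℕ ((a ↑ˡ n) ↑ˡ p) ≡ toℕ (a ↑ˡ (n + p))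
  toℕ-↑ˡ↑ˡ a = trans (toℕ-↑ˡ (a ↑ˡ n) p) (trans (toℕ-↑ˡ a n) (sym (toℕ-↑ˡ a (n + p))))

  toℕ-↑ʳ↑ˡ : (b : Fin n) → toℕ ((m ↑ʳ b) ↑ˡ p) ≡ toℕ (m ↑ʳ (b ↑ˡ p))
  toℕ-↑ʳ↑ˡ b = trans (toℕ-↑ˡ (m ↑ʳ b) p)
    (trans (toℕ-↑ʳ m b) (trans (cong (m +_) (sym (toℕ-↑ˡ b p))) (sym (toℕ-↑ʳ m (b ↑ˡ p)))))

  toℕ-↑ʳ↑ʳ : (c : Fin p) → toℕ ((m + n) ↑ʳ c) ≡ toℕ (m ↑ʳ (n ↑ʳ c))
  toℕ-↑ʳ↑ʳ c = trans (toℕ-↑ʳ (m + n) c)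
    (trans (+-assoc m n (toℕ c)) (trans (cong (m +_) (sym (toℕ-↑ʳ n c))) (sym (toℕ-↑ʳ m (n ↑ʳ c)))))

++-pointwise : ∀ {A : Set} {a b} {u v : Fin (a + b) → A} →
               (∀ x → u (x ↑ˡ b) ≡ v (x ↑ˡ b)) → (∀ y → u (a ↑ʳ y) ≡ v (a ↑ʳ y)) → u ≗ v
++-pointwise {u = u} {v} = ↑-ind (λ i → u i ≡ v i)

copairInj : ∀ {a b m} (f : Inj a m) (g : Inj b m) → .(∀ x y → fun f x ≢ fun g y) → Inj (a + b) m
copairInj {a} {b} f g disjoint = mkInj (fun f ++ fun g) (λ {i} {j} e → splitAt-inj a (by-cases (splitAt a i) (splitAt a j) e))
  where
  by-cases : (s t : Fin a ⊎ Fin b) → [ fun f , fun g ]′ s ≡ [ fun f , fun g ]′ t → s ≡ t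
  by-cases (inj₁ x) (inj₁ y) e = cong inj₁ (inj f e)
  by-cases (inj₁ x) (inj₂ y) e = Irrelevant.⊥-elim (disjoint x y e)
  by-cases (inj₂ x) (inj₁ y) e = Irrelevant.⊥-elim (disjoint y x (sym e))
  by-cases (inj₂ x) (inj₂ y) e = cong inj₂ (inj g e)

pointInj : ∀ {n} → Fin n → Inj 1 n
pointInj j = mkInj (λ _ → j) (λ {a} {b} _ → Fin1-≡ a b)

preimage : ∀ {m n} (f : Inj m n) (i : Fin n) → .(∃ λ j → fun f j ≡ i) → ∃ λ j → fun f j ≡ i
preimage f i h with any? (λ j → fun f j ≟ i)
... | yes p = p
... | no ¬p = Irrelevant.⊥-elim (¬p h)

factorInj : ∀ {s s' M} (h : Inj s M) (g : Inj s' M) → (∀ a → ∃ λ b → fun g b ≡ fun h a) → Inj s s'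
factorInj h g lift-h = mkInj (λ a → proj₁ (lift-h a))
  (λ {a} {a'} e → inj h (trans (sym (proj₂ (lift-h a))) (trans (cong (fun g) e) (proj₂ (lift-h a')))))

record Enumeration {m : ℕ} (P : Fin m → Set) : Set where
  constructor mkEnumeration
  field
    size     : ℕ
    embed    : Inj size m
    sound    : ∀ a → P (fun embed a)
    complete : ∀ j → P j → ∃ λ a → fun embed a ≡ j
open Enumeration public

enumerate : ∀ {m} (P : Fin m → Set) → (∀ j → Dec (P j)) → Enumeration P
enumerate {ℕ.zero} P P? = mkEnumeration 0 (mkInj (λ ()) (λ { {()} })) (λ ()) (λ ())
enumerate {ℕ.suc m} P P? = extend (enumerate (λ j → P (suc j)) (λ j → P? (suc j))) (P? zero)
  where
  extend : Enumeration (λ j → P (suc j)) → Dec (P zero) → Enumeration P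
  extend (mkEnumeration s ι sd cp) (yes p) = mkEnumeration (ℕ.suc s) ι⁺ sd⁺ cp⁺
    where
    ι⁺fun : Fin (ℕ.suc s) → Fin (ℕ.suc m)
    ι⁺fun zero = zero
    ι⁺fun (suc a) = suc (fun ι a)
    ι⁺inj : ∀ a b → ι⁺fun a ≡ ι⁺fun b → a ≡ b
    ι⁺inj zero zero e = refl
    ι⁺inj (suc a) (suc b) e = cong suc (inj ι (suc-injective e))
    ι⁺ = mkInj ι⁺fun (ι⁺inj _ _)
    sd⁺ : ∀ a → P (ι⁺fun a)
    sd⁺ zero = p
    sd⁺ (suc a) = sd a
    cp⁺ : ∀ j → P j → ∃ λ a → ι⁺fun a ≡ j
    cp⁺ zero q = zero , refl
    cp⁺ (suc j) q = let (a , e) = cp j q in suc a , cong suc e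
  extend (mkEnumeration s ι sd cp) (no ¬p) =
    mkEnumeration s (mkInj (λ a → suc (fun ι a)) (λ e → inj ι (suc-injective e))) sd cp⁺
    where
    cp⁺ : ∀ j → P j → ∃ λ a → suc (fun ι a) ≡ j
    cp⁺ zero q = ⊥-elim (¬p q)
    cp⁺ (suc j) q = let (a , e) = cp j q in a , cong suc e

module _ (m n p : ℕ) where

  assoc-↑ˡ↑ˡ : (a : Fin m) → cast (+-assoc m n p) ((a ↑ˡ n) ↑ˡ p) ≡ a ↑ˡ (n + p)
  assoc-↑ˡ↑ˡ a = cast-toℕ _ (toℕ-↑ˡ↑ˡ m n p a)

  assoc-↑ʳ↑ˡ : (b : Fin n) → cast (+-assoc m n p) ((m ↑ʳ b) ↑ˡ p) ≡ m ↑ʳ (b ↑ˡ p)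
  assoc-↑ʳ↑ˡ b = cast-toℕ _ (toℕ-↑ʳ↑ˡ m n p b)

  assoc-↑ʳ : (c : Fin p) → cast (+-assoc m n p) ((m + n) ↑ʳ c) ≡ m ↑ʳ (n ↑ʳ c)
  assoc-↑ʳ c = cast-toℕ _ (toℕ-↑ʳ↑ʳ m n p c)

  assoc⁻¹-↑ˡ : (a : Fin m) → cast (sym (+-assoc m n p)) (a ↑ˡ (n + p)) ≡ (a ↑ˡ n) ↑ˡ p
  assoc⁻¹-↑ˡ a = cast-toℕ _ (sym (toℕ-↑ˡ↑ˡ m n p a))

  assoc⁻¹-↑ʳ↑ˡ : (b : Fin n) → cast (sym (+-assoc m n p)) (m ↑ʳ (b ↑ˡ p)) ≡ (m ↑ʳ b) ↑ˡ p
  assoc⁻¹-↑ʳ↑ˡ b = cast-toℕ _ (sym (toℕ-↑ʳ↑ˡ m n p b))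

  assoc⁻¹-↑ʳ↑ʳ : (c : Fin p) → cast (sym (+-assoc m n p)) (m ↑ʳ (n ↑ʳ c)) ≡ (m + n) ↑ʳ c
  assoc⁻¹-↑ʳ↑ʳ c = cast-toℕ _ (sym (toℕ-↑ʳ↑ʳ m n p c))

++-pointwise₃ : ∀ {A : Set} {m n p} {u v : Fin ((m + n) + p) → A} →
                (∀ a → u ((a ↑ˡ n) ↑ˡ p) ≡ v ((a ↑ˡ n) ↑ˡ p)) →
                (∀ b → u ((m ↑ʳ b) ↑ˡ p) ≡ v ((m ↑ʳ b) ↑ˡ p)) →
                (∀ c → u ((m + n) ↑ʳ c) ≡ v ((m + n) ↑ʳ c)) → u ≗ v
++-pointwise₃ {u = u} {v} onˡˡ onʳˡ onʳ =
  ++-pointwise (++-pointwise {u = λ i → u (i ↑ˡ _)} {v = λ i → v (i ↑ˡ _)} onˡˡ onʳˡ) onʳ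

⊗-factor : ∀ {a b a′ b′ n} (j : Inj (a + b) n) (j′ : Inj (a′ + b′) n) (π₁ : Inj a a′) (π₂ : Inj b b′) →
           (∀ x → fun j′ (fun π₁ x ↑ˡ b′) ≡ fun j (x ↑ˡ b)) →
           (∀ y → fun j′ (a′ ↑ʳ fun π₂ y) ≡ fun j (a ↑ʳ y)) →
           j ≈I (j′ ∘I (π₁ ⊗I π₂))
⊗-factor j j′ π₁ π₂ onˡ onʳ = ++-pointwise
  (λ x → sym (trans (cong (fun j′) (⊗fun-↑ˡ (fun π₁) (fun π₂) x)) (onˡ x)))
  (λ y → sym (trans (cong (fun j′) (⊗fun-↑ʳ (fun π₁) (fun π₂) y)) (onʳ y)))

module _ {m₁ m₁′ m₂ m₂′ n} (g : Inj m₁ m₁′) (h : Inj m₂ m₂′) (K : Inj (m₁′ + m₂′) n) (K′ : Inj (m₁ + m₂) n)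
         (p : K′ ≈I (K ∘I (g ⊗I h))) where

  coend-inclL : (K ∘I inclL m₂′ ∘I g) ≈I (K′ ∘I inclL m₂)
  coend-inclL a = sym (trans (p (a ↑ˡ m₂)) (cong (fun K) (⊗fun-↑ˡ (fun g) (fun h) a)))

  coend-inclR : (K ∘I inclR m₁′ ∘I h) ≈I (K′ ∘I inclR m₁)
  coend-inclR c = sym (trans (p (m₁ ↑ʳ c)) (cong (fun K) (⊗fun-↑ʳ (fun g) (fun h) c)))

module _ {m₁ m₂ n} (f : Inj (m₁ + m₂) n) where

  strLInj : Inj (m₁ + (m₂ + 1)) (n + 1)
  strLInj = (f ⊗I idI {1}) ∘I castI (sym (+-assoc m₁ m₂ 1))

  strLInj-↑ˡ : ∀ a → fun strLInj (a ↑ˡ (m₂ + 1)) ≡ fun f (a ↑ˡ m₂) ↑ˡ 1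
  strLInj-↑ˡ a = trans (cong (⊗fun (fun f) _) (assoc⁻¹-↑ˡ m₁ m₂ 1 a)) (⊗fun-↑ˡ (fun f) _ (a ↑ˡ m₂))

  strLInj-↑ʳ↑ˡ : ∀ c → fun strLInj (m₁ ↑ʳ (c ↑ˡ 1)) ≡ fun f (m₁ ↑ʳ c) ↑ˡ 1
  strLInj-↑ʳ↑ˡ c = trans (cong (⊗fun (fun f) _) (assoc⁻¹-↑ʳ↑ˡ m₁ m₂ 1 c)) (⊗fun-↑ˡ (fun f) _ (m₁ ↑ʳ c))

  strLInj-↑ʳ↑ʳ : ∀ b → fun strLInj (m₁ ↑ʳ (m₂ ↑ʳ b)) ≡ n ↑ʳ b
  strLInj-↑ʳ↑ʳ b = trans (cong (⊗fun (fun f) _) (assoc⁻¹-↑ʳ↑ʳ m₁ m₂ 1 b)) (⊗fun-↑ʳ (fun f) _ b)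

  strRInj : Inj ((m₁ + 1) + m₂) (n + 1)
  strRInj = (f ⊗I idI {1}) ∘I theta m₁ m₂

  private
    F : Fin ((m₁ + m₂) + 1) → Fin (n + 1)
    F = ⊗fun (fun f) (λ i → i)
    α⁻¹ : Fin (m₁ + (m₂ + 1)) → Fin ((m₁ + m₂) + 1)
    α⁻¹ = cast (sym (+-assoc m₁ m₂ 1))
    θ : Fin (m₁ + (1 + m₂)) → Fin (m₁ + (m₂ + 1))
    θ = ⊗fun (λ i → i) (fun (blockSwap 1 m₂))
    α : Fin ((m₁ + 1) + m₂) → Fin (m₁ + (1 + m₂))
    α = cast (+-assoc m₁ 1 m₂)

  strRInj-↑ˡ↑ˡ : ∀ a → fun strRInj ((a ↑ˡ 1) ↑ˡ m₂) ≡ fun f (a ↑ˡ m₂) ↑ˡ 1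
  strRInj-↑ˡ↑ˡ a = begin
    F (α⁻¹ (θ (α ((a ↑ˡ 1) ↑ˡ m₂))))  ≡⟨ cong (λ i → F (α⁻¹ (θ i))) (assoc-↑ˡ↑ˡ m₁ 1 m₂ a) ⟩
    F (α⁻¹ (θ (a ↑ˡ (1 + m₂))))       ≡⟨ cong (λ i → F (α⁻¹ i)) (⊗fun-↑ˡ (λ i → i) (fun (blockSwap 1 m₂)) a) ⟩
    F (α⁻¹ (a ↑ˡ (m₂ + 1)))           ≡⟨ strLInj-↑ˡ a ⟩
    fun f (a ↑ˡ m₂) ↑ˡ 1              ∎
    where open ≡-Reasoning

  strRInj-↑ʳ↑ˡ : ∀ b → fun strRInj ((m₁ ↑ʳ b) ↑ˡ m₂) ≡ n ↑ʳ b
  strRInj-↑ʳ↑ˡ b = begin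
    F (α⁻¹ (θ (α ((m₁ ↑ʳ b) ↑ˡ m₂))))        ≡⟨ cong (λ i → F (α⁻¹ (θ i))) (assoc-↑ʳ↑ˡ m₁ 1 m₂ b) ⟩
    F (α⁻¹ (θ (m₁ ↑ʳ (b ↑ˡ m₂))))            ≡⟨ cong (λ i → F (α⁻¹ i)) (⊗fun-↑ʳ (λ i → i) (fun (blockSwap 1 m₂)) (b ↑ˡ m₂)) ⟩
    F (α⁻¹ (m₁ ↑ʳ fun (blockSwap 1 m₂) (b ↑ˡ m₂))) ≡⟨ cong (λ i → F (α⁻¹ (m₁ ↑ʳ i))) (blockSwap-↑ˡ 1 m₂ b) ⟩
    F (α⁻¹ (m₁ ↑ʳ (m₂ ↑ʳ b)))                ≡⟨ strLInj-↑ʳ↑ʳ b ⟩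
    n ↑ʳ b                                   ∎
    where open ≡-Reasoning

  strRInj-↑ʳ : ∀ c → fun strRInj ((m₁ + 1) ↑ʳ c) ≡ fun f (m₁ ↑ʳ c) ↑ˡ 1
  strRInj-↑ʳ c = begin
    F (α⁻¹ (θ (α ((m₁ + 1) ↑ʳ c))))         ≡⟨ cong (λ i → F (α⁻¹ (θ i))) (assoc-↑ʳ m₁ 1 m₂ c) ⟩
    F (α⁻¹ (θ (m₁ ↑ʳ (1 ↑ʳ c))))            ≡⟨ cong (λ i → F (α⁻¹ i)) (⊗fun-↑ʳ (λ i → i) (fun (blockSwap 1 m₂)) (1 ↑ʳ c)) ⟩
    F (α⁻¹ (m₁ ↑ʳ fun (blockSwap 1 m₂) (1 ↑ʳ c))) ≡⟨ cong (λ i → F (α⁻¹ (m₁ ↑ʳ i))) (blockSwap-↑ʳ 1 m₂ c) ⟩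
    F (α⁻¹ (m₁ ↑ʳ (c ↑ˡ 1)))                ≡⟨ strLInj-↑ʳ↑ˡ c ⟩
    fun f (m₁ ↑ʳ c) ↑ˡ 1                    ∎
    where open ≡-Reasoning

module _ {m₁ m₂ p₁ p₂ n} (g : Inj (m₁ + m₂) n) (f : Inj (p₁ + p₂) m₂) where

  assocInj : Inj ((m₁ + p₁) + p₂) n
  assocInj = g ∘I (idI {m₁} ⊗I f) ∘I castI (+-assoc m₁ p₁ p₂)

  private
    F : Fin (m₁ + (p₁ + p₂)) → Fin (m₁ + m₂)
    F = ⊗fun (λ i → i) (fun f)

  assocInj-↑ˡ↑ˡ : ∀ a → fun assocInj ((a ↑ˡ p₁) ↑ˡ p₂) ≡ fun g (a ↑ˡ m₂)
  assocInj-↑ˡ↑ˡ a = cong (fun g) (trans (cong F (assoc-↑ˡ↑ˡ m₁ p₁ p₂ a)) (⊗fun-↑ˡ (λ i → i) (fun f) a))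

  assocInj-↑ʳ↑ˡ : ∀ c → fun assocInj ((m₁ ↑ʳ c) ↑ˡ p₂) ≡ fun g (m₁ ↑ʳ fun f (c ↑ˡ p₂))
  assocInj-↑ʳ↑ˡ c = cong (fun g) (trans (cong F (assoc-↑ʳ↑ˡ m₁ p₁ p₂ c)) (⊗fun-↑ʳ (λ i → i) (fun f) (c ↑ˡ p₂)))

  assocInj-↑ʳ : ∀ w → fun assocInj ((m₁ + p₁) ↑ʳ w) ≡ fun g (m₁ ↑ʳ fun f (p₁ ↑ʳ w))
  assocInj-↑ʳ w = cong (fun g) (trans (cong F (assoc-↑ʳ m₁ p₁ p₂ w)) (⊗fun-↑ʳ (λ i → i) (fun f) (p₁ ↑ʳ w)))

module _ {m : ℕ} where

  swapInj : Inj ((m + 1) + 1) ((m + 1) + 1)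
  swapInj = castI (sym (+-assoc m 1 1)) ∘I (idI {m} ⊗I s) ∘I castI (+-assoc m 1 1)

  private
    α⁻¹ : Fin (m + (1 + 1)) → Fin ((m + 1) + 1)
    α⁻¹ = cast (sym (+-assoc m 1 1))
    S : Fin (m + (1 + 1)) → Fin (m + (1 + 1))
    S = ⊗fun (λ i → i) (fun s)

  swapInj-↑ˡ↑ˡ : ∀ a → fun swapInj ((a ↑ˡ 1) ↑ˡ 1) ≡ (a ↑ˡ 1) ↑ˡ 1
  swapInj-↑ˡ↑ˡ a = begin
    α⁻¹ (S (cast _ ((a ↑ˡ 1) ↑ˡ 1))) ≡⟨ cong (α⁻¹ ∘ S) (assoc-↑ˡ↑ˡ m 1 1 a) ⟩
    α⁻¹ (S (a ↑ˡ 2))                 ≡⟨ cong α⁻¹ (⊗fun-↑ˡ (λ i → i) (fun s) a) ⟩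
    α⁻¹ (a ↑ˡ 2)                     ≡⟨ assoc⁻¹-↑ˡ m 1 1 a ⟩
    (a ↑ˡ 1) ↑ˡ 1                    ∎
    where open ≡-Reasoning

  swapInj-↑ʳ↑ˡ : ∀ b → fun swapInj ((m ↑ʳ b) ↑ˡ 1) ≡ (m + 1) ↑ʳ b
  swapInj-↑ʳ↑ˡ b = begin
    α⁻¹ (S (cast _ ((m ↑ʳ b) ↑ˡ 1)))   ≡⟨ cong (α⁻¹ ∘ S) (assoc-↑ʳ↑ˡ m 1 1 b) ⟩
    α⁻¹ (S (m ↑ʳ (b ↑ˡ 1)))            ≡⟨ cong α⁻¹ (⊗fun-↑ʳ (λ i → i) (fun s) (b ↑ˡ 1)) ⟩
    α⁻¹ (m ↑ʳ fun s (b ↑ˡ 1))          ≡⟨ cong (λ i → α⁻¹ (m ↑ʳ i)) (blockSwap-↑ˡ 1 1 b) ⟩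
    α⁻¹ (m ↑ʳ (1 ↑ʳ b))                ≡⟨ assoc⁻¹-↑ʳ↑ʳ m 1 1 b ⟩
    (m + 1) ↑ʳ b                       ∎
    where open ≡-Reasoning

  swapInj-↑ʳ : ∀ b → fun swapInj ((m + 1) ↑ʳ b) ≡ (m ↑ʳ b) ↑ˡ 1
  swapInj-↑ʳ b = begin
    α⁻¹ (S (cast _ ((m + 1) ↑ʳ b)))    ≡⟨ cong (α⁻¹ ∘ S) (assoc-↑ʳ m 1 1 b) ⟩
    α⁻¹ (S (m ↑ʳ (1 ↑ʳ b)))            ≡⟨ cong α⁻¹ (⊗fun-↑ʳ (λ i → i) (fun s) (1 ↑ʳ b)) ⟩
    α⁻¹ (m ↑ʳ fun s (1 ↑ʳ b))          ≡⟨ cong (λ i → α⁻¹ (m ↑ʳ i)) (blockSwap-↑ʳ 1 1 b) ⟩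
    α⁻¹ (m ↑ʳ (b ↑ˡ 1))                ≡⟨ assoc⁻¹-↑ʳ↑ˡ m 1 1 b ⟩
    (m ↑ʳ b) ↑ˡ 1                      ∎
    where open ≡-Reasoning

  upInj : Inj m (m + 1)
  upInj = (idI {m} ⊗I w) ∘I castI (sym (+-identityʳ m))

  fun-upInj : ∀ a → fun upInj a ≡ a ↑ˡ 1
  fun-upInj a = trans (cong (⊗fun (λ i → i) (fun w)) (cast-toℕ _ (sym (toℕ-↑ˡ a 0)))) (⊗fun-↑ˡ (λ i → i) (fun w) a)

-- lift k n is n + 1 + ⋯ + 1 bracketed to the left, so that δ^ k X at n unfolds to X at lift k n.
lift : ℕ → ℕ → ℕ
lift ℕ.zero n = n
lift (ℕ.suc k) n = lift k (n + 1)

wk : ∀ {n} → Inj n (n + 1)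
wk = inclL 1

wk^ : ∀ k {n} → Fin n → Fin (lift k n)
wk^ ℕ.zero i = i
wk^ (ℕ.suc k) i = wk^ k (i ↑ˡ 1)

ext : ∀ {n m} → Inj n m → Inj (n + 1) (m + 1)
ext f = f ⊗I idI

ext^ : ∀ k {n m} → Inj n m → Inj (lift k n) (lift k m)
ext^ ℕ.zero f = f
ext^ (ℕ.suc k) f = ext^ k (ext f)

ext^-cong : ∀ k {n m} {f g : Inj n m} → f ≈I g → ext^ k f ≈I ext^ k g
ext^-cong ℕ.zero p = p
ext^-cong (ℕ.suc k) {f = f} {g} p = ext^-cong k (⊗-cong {f = f} {g} {idI {1}} {idI {1}} p λ _ → refl)

ext^-∘ : ∀ k {n m o} (g : Inj m o) (f : Inj n m) → ext^ k (g ∘I f) ≈I (ext^ k g ∘I ext^ k f)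
ext^-∘ ℕ.zero g f i = refl
ext^-∘ (ℕ.suc k) g f i = trans (ext^-cong k (⊗-∘ g f idI idI) i) (ext^-∘ k (ext g) (ext f) i)

ext^-id : ∀ k {n} → ext^ k (idI {n}) ≈I idI
ext^-id ℕ.zero i = refl
ext^-id (ℕ.suc k) {n} i = trans (ext^-cong k (⊗-id {n} {1}) i) (ext^-id k i)

ext^-wk^ : ∀ k {n m} (f : Inj n m) i → fun (ext^ k f) (wk^ k i) ≡ wk^ k (fun f i)
ext^-wk^ ℕ.zero f i = refl
ext^-wk^ (ℕ.suc k) f i = trans (ext^-wk^ k (ext f) (i ↑ˡ 1)) (cong (wk^ k) (⊗fun-↑ˡ (fun f) (λ j → j) i))

ext^-square : ∀ k {m m′ n n′} {f : Inj n n′} {ι : Inj m n} {ι′ : Inj m′ n′} {g : Inj m m′} →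
              (ι′ ∘I g) ≈I (f ∘I ι) → (ext^ k ι′ ∘I ext^ k g) ≈I (ext^ k f ∘I ext^ k ι)
ext^-square k {f = f} {ι} {ι′} {g} sq j = trans (sym (ext^-∘ k ι′ g j)) (trans (ext^-cong k sq j) (ext^-∘ k f ι j))

≈sym : ∀ (X : Psh) {n} {x y : Ob X n} → Eq X x y → Eq X y x
≈sym X = IsEquivalence.sym (isEquiv X)

≈reflexive : ∀ (X : Psh) {n} {x y : Ob X n} → x ≡ y → Eq X x y
≈reflexive X = IsEquivalence.reflexive (isEquiv X)

module _ (X : Psh) where

  out^ : ∀ k {n} → Ob (δ^ k X) n → Ob X (lift k n)
  out^ ℕ.zero x = x
  out^ (ℕ.suc k) {n} x = out^ k {n + 1} x

  in^ : ∀ k {n} → Ob X (lift k n) → Ob (δ^ k X) n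
  in^ ℕ.zero x = x
  in^ (ℕ.suc k) {n} x = in^ k {n + 1} x

  out^-cong : ∀ k {n} {x y : Ob (δ^ k X) n} → Eq (δ^ k X) x y → Eq X (out^ k x) (out^ k y)
  out^-cong ℕ.zero p = p
  out^-cong (ℕ.suc k) {n} p = out^-cong k {n + 1} p

  in^-cong : ∀ k {n} {x y : Ob X (lift k n)} → Eq X x y → Eq (δ^ k X) (in^ k x) (in^ k y)
  in^-cong ℕ.zero p = p
  in^-cong (ℕ.suc k) {n} p = in^-cong k {n + 1} p

  out^-in^ : ∀ k {n} (x : Ob X (lift k n)) → out^ k (in^ k x) ≡ x
  out^-in^ ℕ.zero x = refl
  out^-in^ (ℕ.suc k) {n} x = out^-in^ k {n + 1} x

  in^-out^ : ∀ k {n} (x : Ob (δ^ k X) n) → in^ k (out^ k x) ≡ x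
  in^-out^ ℕ.zero x = refl
  in^-out^ (ℕ.suc k) {n} x = in^-out^ k {n + 1} x

  out^-act : ∀ k {m n} (f : Inj m n) (x : Ob (δ^ k X) m) →
             out^ k (act (δ^ k X) f x) ≡ act X (ext^ k f) (out^ k x)
  out^-act ℕ.zero f x = refl
  out^-act (ℕ.suc k) f x = out^-act k (ext f) x

  in^-act : ∀ k {m n} (f : Inj m n) (x : Ob X (lift k m)) →
            act (δ^ k X) f (in^ k x) ≡ in^ k (act X (ext^ k f) x)
  in^-act ℕ.zero f x = refl
  in^-act (ℕ.suc k) f x = in^-act k (ext f) x

out^-δ^map : ∀ k {X Y : Psh} (F : Fun X Y) {n} (x : Ob (δ^ k X) n) → out^ Y k (δ^map k F x) ≡ F (out^ X k x)
out^-δ^map ℕ.zero F x = refl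
out^-δ^map (ℕ.suc k) {X} {Y} F {n} x = out^-δ^map k {X} {Y} F {n + 1} x

δ^map-id : ∀ k {X : Psh} {n} (x : Ob (δ^ k X) n) → δ^map k (idF X) x ≡ x
δ^map-id ℕ.zero x = refl
δ^map-id (ℕ.suc k) {X} {n} x = δ^map-id k {X} {n + 1} x

δ^map-∘ : ∀ k {X Y Z : Psh} (F : Fun Y Z) (G : Fun X Y) {n} (x : Ob (δ^ k X) n) →
          δ^map k {X} {Z} (λ z → F (G z)) x ≡ δ^map k {Y} {Z} F (δ^map k {X} {Y} G x)
δ^map-∘ ℕ.zero F G x = refl
δ^map-∘ (ℕ.suc k) {X} {Y} {Z} F G {n} x = δ^map-∘ k {X} {Y} {Z} F G {n + 1} x

sigProdMap-id : ∀ ks {X : Psh} {n} (x : Ob (SigProd X ks) n) → Eq (SigProd X ks) (sigProdMap ks (idF X) x) x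
sigProdMap-id [] x = tt
sigProdMap-id (k ∷ []) {X} x = ≈reflexive (δ^ k X) (δ^map-id k x)
sigProdMap-id (k ∷ k′ ∷ ks) {X} ⟦ x , y , j ⟧ =
  fwd (resp (≈reflexive (δ^ k X) (δ^map-id k x)) (sigProdMap-id (k′ ∷ ks) y) (λ _ → refl)) ◅ ε

sigProdMap-∘ : ∀ ks {X Y Z : Psh} (F : Fun Y Z) (G : Fun X Y) {n} (x : Ob (SigProd X ks) n) →
               sigProdMap {X} {Z} ks (λ z → F (G z)) x ≡
               sigProdMap {Y} {Z} ks F (sigProdMap {X} {Y} ks G x)
sigProdMap-∘ [] F G x = refl
sigProdMap-∘ (k ∷ []) {X} {Y} {Z} F G x = δ^map-∘ k {X} {Y} {Z} F G x
sigProdMap-∘ (k ∷ k′ ∷ ks) {X} {Y} {Z} F G ⟦ x , y , j ⟧ =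
  cong₂ (λ a b → ⟦ a , b , j ⟧) (δ^map-∘ k {X} {Y} {Z} F G x)
                                (sigProdMap-∘ (k′ ∷ ks) {X} {Y} {Z} F G y)

idH : ∀ {X} → Hom X X
idH {X} = record { hom = idF X ; hom-cong = λ p → p ; nat = λ f x → ≈refl X }

infixr 9 _∘H_
_∘H_ : ∀ {X Y Z} → Hom Y Z → Hom X Y → Hom X Z
_∘H_ {Z = Z} G F = record
  { hom = λ x → hom G (hom F x)
  ; hom-cong = λ p → hom-cong G (hom-cong F p)
  ; nat = λ f x → ≈trans Z (hom-cong G (nat F f x)) (nat G f (hom F x))
  }

δHom : ∀ {X Y} → Hom X Y → Hom (δ X) (δ Y)
δHom {X} {Y} F = record
  { hom = δmap {X} {Y} (hom F)
  ; hom-cong = hom-cong F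
  ; nat = λ f → nat F (f ⊗I idI)
  }

dayHom : ∀ {X X′ Y Y′} → Hom X X′ → Hom Y Y′ → Hom (X ⊗̂ Y) (X′ ⊗̂ Y′)
dayHom {X} {X′} {Y} {Y′} F G = record
  { hom = dayMap {X} {X′} {Y} {Y′} (hom F) (hom G)
  ; hom-cong = gfold (isEquiv (X′ ⊗̂ Y′)) F⊗G generator
  ; nat = λ { f ⟦ x , y , k ⟧ → ≈refl (X′ ⊗̂ Y′) }
  }
  where
  F⊗G : Fun (X ⊗̂ Y) (X′ ⊗̂ Y′)
  F⊗G = dayMap {X} {X′} {Y} {Y′} (hom F) (hom G)
  generator : ∀ {n} {d d′ : DayEl X Y n} → DayGen X Y d d′ → Eq (X′ ⊗̂ Y′) (F⊗G d) (F⊗G d′)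
  generator (coend g h x y k k′ p) =
    fwd (resp (nat F g x) (nat G h y) (λ _ → refl)) ◅ fwd (coend g h (hom F x) (hom G y) k k′ p) ◅ ε
  generator (resp px py pk) = fwd (resp (hom-cong F px) (hom-cong G py) pk) ◅ ε

day-≈ : ∀ {X Y : Psh} {n m₁ m₂ m₁′ m₂′} {x : Ob X m₁} {y : Ob Y m₂} {x′ : Ob X m₁′} {y′ : Ob Y m₂′}
        {j : Inj (m₁ + m₂) n} {j′ : Inj (m₁′ + m₂′) n} (π₁ : Inj m₁ m₁′) (π₂ : Inj m₂ m₂′) →
        j ≈I (j′ ∘I (π₁ ⊗I π₂)) → Eq X (act X π₁ x) x′ → Eq Y (act Y π₂ y) y′ →
        Eq (X ⊗̂ Y) ⟦ x , y , j ⟧ ⟦ x′ , y′ , j′ ⟧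
day-≈ {x = x} {y} {j = j} {j′} π₁ π₂ sq px py =
  bwd (coend π₁ π₂ x y j′ j sq) ◅ fwd (resp px py (λ _ → refl)) ◅ ε

lastVariable : ∀ {T} → Hom V T → Hom One (δ T)
lastVariable {T} η = record
  { hom = λ {n} _ → hom η (inclR n {1})
  ; hom-cong = λ _ → ≈refl T
  ; nat = λ {m} f _ → ≈trans T (hom-cong η λ z → sym (⊗fun-↑ʳ (fun f) (λ i → i) z))
                               (nat η (f ⊗I idI {1}) (inclR m {1}))
  }

-- Terms over a binding signature

module Syntax (S : BindingSignature) where

  mutual
    data Tm (n : ℕ) : Set where
      var : Fin n → Tm n
      op  : (ω : Op S) → Args (ar S ω) n → Tm n

    data Args : List ℕ → ℕ → Set where
      []  : ∀ {n} → Args [] n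
      _∷_ : ∀ {k ks n} → Tm (lift k n) → Args ks n → Args (k ∷ ks) n

  mutual
    ren : ∀ {n m} → Inj n m → Tm n → Tm m
    ren f (var i) = var (fun f i)
    ren f (op ω ts) = op ω (renArgs f ts)

    renArgs : ∀ {ks n m} → Inj n m → Args ks n → Args ks m
    renArgs f [] = []
    renArgs f (_∷_ {k} t ts) = ren (ext^ k f) t ∷ renArgs f ts

  mutual
    ren-cong : ∀ {n m} {f g : Inj n m} → f ≈I g → (t : Tm n) → ren f t ≡ ren g t
    ren-cong p (var i) = cong var (p i)
    ren-cong p (op ω ts) = cong (op ω) (renArgs-cong p ts)

    renArgs-cong : ∀ {ks n m} {f g : Inj n m} → f ≈I g → (ts : Args ks n) → renArgs f ts ≡ renArgs g ts
    renArgs-cong p [] = refl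
    renArgs-cong p (_∷_ {k} t ts) = cong₂ _∷_ (ren-cong (ext^-cong k p) t) (renArgs-cong p ts)

  mutual
    ren-∘ : ∀ {n m o} (g : Inj m o) (f : Inj n m) (t : Tm n) → ren (g ∘I f) t ≡ ren g (ren f t)
    ren-∘ g f (var i) = refl
    ren-∘ g f (op ω ts) = cong (op ω) (renArgs-∘ g f ts)

    renArgs-∘ : ∀ {ks n m o} (g : Inj m o) (f : Inj n m) (ts : Args ks n) →
                renArgs (g ∘I f) ts ≡ renArgs g (renArgs f ts)
    renArgs-∘ g f [] = refl
    renArgs-∘ g f (_∷_ {k} t ts) =
      cong₂ _∷_ (trans (ren-cong (ext^-∘ k g f) t) (ren-∘ (ext^ k g) (ext^ k f) t)) (renArgs-∘ g f ts)

  mutual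
    ren-id : ∀ {n} (t : Tm n) → ren idI t ≡ t
    ren-id (var i) = refl
    ren-id (op ω ts) = cong (op ω) (renArgs-id ts)

    renArgs-id : ∀ {ks n} (ts : Args ks n) → renArgs idI ts ≡ ts
    renArgs-id [] = refl
    renArgs-id (_∷_ {k} t ts) = cong₂ _∷_ (trans (ren-cong (ext^-id k) t) (ren-id t)) (renArgs-id ts)

  Subst : ℕ → ℕ → Set
  Subst n m = Fin n → Tm m

  exts : ∀ {n m} → Subst n m → Subst (n + 1) (m + 1)
  exts {m = m} ρ = (λ a → ren wk (ρ a)) ++ (λ b → var (m ↑ʳ b))

  exts^ : ∀ k {n m} → Subst n m → Subst (lift k n) (lift k m)
  exts^ ℕ.zero ρ = ρ
  exts^ (ℕ.suc k) ρ = exts^ k (exts ρ)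

  mutual
    sub : ∀ {n m} → Subst n m → Tm n → Tm m
    sub ρ (var i) = ρ i
    sub ρ (op ω ts) = op ω (subArgs ρ ts)

    subArgs : ∀ {ks n m} → Subst n m → Args ks n → Args ks m
    subArgs ρ [] = []
    subArgs ρ (_∷_ {k} t ts) = sub (exts^ k ρ) t ∷ subArgs ρ ts

  exts-↑ˡ : ∀ {n m} (ρ : Subst n m) a → exts ρ (a ↑ˡ 1) ≡ ren wk (ρ a)
  exts-↑ˡ {m = m} ρ = lookup-++ˡ (λ a → ren wk (ρ a)) (λ b → var (m ↑ʳ b))

  exts-↑ʳ : ∀ {n m} (ρ : Subst n m) b → exts ρ (n ↑ʳ b) ≡ var (m ↑ʳ b)
  exts-↑ʳ {m = m} ρ = lookup-++ʳ (λ a → ren wk (ρ a)) (λ b → var (m ↑ʳ b))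

  exts-cong : ∀ {n m} {ρ τ : Subst n m} → ρ ≗ τ → exts ρ ≗ exts τ
  exts-cong {ρ = ρ} {τ} p = ++-pointwise
    (λ a → trans (exts-↑ˡ ρ a) (trans (cong (ren wk) (p a)) (sym (exts-↑ˡ τ a))))
    (λ b → trans (exts-↑ʳ ρ b) (sym (exts-↑ʳ τ b)))

  exts^-cong : ∀ k {n m} {ρ τ : Subst n m} → ρ ≗ τ → exts^ k ρ ≗ exts^ k τ
  exts^-cong ℕ.zero p = p
  exts^-cong (ℕ.suc k) p = exts^-cong k (exts-cong p)

  mutual
    sub-cong : ∀ {n m} {ρ τ : Subst n m} → ρ ≗ τ → (t : Tm n) → sub ρ t ≡ sub τ t
    sub-cong p (var i) = p i
    sub-cong p (op ω ts) = cong (op ω) (subArgs-cong p ts)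

    subArgs-cong : ∀ {ks n m} {ρ τ : Subst n m} → ρ ≗ τ → (ts : Args ks n) → subArgs ρ ts ≡ subArgs τ ts
    subArgs-cong p [] = refl
    subArgs-cong p (_∷_ {k} t ts) = cong₂ _∷_ (sub-cong (exts^-cong k p) t) (subArgs-cong p ts)

  exts-ext : ∀ {n m o} (ρ : Subst m o) (f : Inj n m) → (λ i → exts ρ (fun (ext f) i)) ≗ exts (λ i → ρ (fun f i))
  exts-ext ρ f = ++-pointwise
    (λ a → trans (cong (exts ρ) (⊗fun-↑ˡ (fun f) _ a))
                 (trans (exts-↑ˡ ρ (fun f a)) (sym (exts-↑ˡ (λ i → ρ (fun f i)) a))))
    (λ b → trans (cong (exts ρ) (⊗fun-↑ʳ (fun f) _ b)) (trans (exts-↑ʳ ρ b) (sym (exts-↑ʳ (λ i → ρ (fun f i)) b))))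

  exts^-ext^ : ∀ k {n m o} (ρ : Subst m o) (f : Inj n m) →
               (λ i → exts^ k ρ (fun (ext^ k f) i)) ≗ exts^ k (λ i → ρ (fun f i))
  exts^-ext^ ℕ.zero ρ f i = refl
  exts^-ext^ (ℕ.suc k) ρ f i = trans (exts^-ext^ k (exts ρ) (ext f) i) (exts^-cong k (exts-ext ρ f) i)

  mutual
    sub-ren : ∀ {n m o} (ρ : Subst m o) (f : Inj n m) (t : Tm n) → sub ρ (ren f t) ≡ sub (λ i → ρ (fun f i)) t
    sub-ren ρ f (var i) = refl
    sub-ren ρ f (op ω ts) = cong (op ω) (subArgs-renArgs ρ f ts)

    subArgs-renArgs : ∀ {ks n m o} (ρ : Subst m o) (f : Inj n m) (ts : Args ks n) →
                      subArgs ρ (renArgs f ts) ≡ subArgs (λ i → ρ (fun f i)) ts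
    subArgs-renArgs ρ f [] = refl
    subArgs-renArgs ρ f (_∷_ {k} t ts) =
      cong₂ _∷_ (trans (sub-ren (exts^ k ρ) (ext^ k f) t) (sub-cong (exts^-ext^ k ρ f) t)) (subArgs-renArgs ρ f ts)

  ren-exts : ∀ {n m o} (f : Inj m o) (ρ : Subst n m) → (λ i → ren (ext f) (exts ρ i)) ≗ exts (λ i → ren f (ρ i))
  ren-exts f ρ = ++-pointwise
    (λ a → begin
      ren (ext f) (exts ρ (a ↑ˡ 1))   ≡⟨ cong (ren (ext f)) (exts-↑ˡ ρ a) ⟩
      ren (ext f) (ren wk (ρ a))      ≡⟨ sym (ren-∘ (ext f) wk (ρ a)) ⟩
      ren (ext f ∘I wk) (ρ a)         ≡⟨ ren-cong (⊗fun-↑ˡ (fun f) _) (ρ a) ⟩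
      ren (wk ∘I f) (ρ a)             ≡⟨ ren-∘ wk f (ρ a) ⟩
      ren wk (ren f (ρ a))            ≡⟨ sym (exts-↑ˡ (λ i → ren f (ρ i)) a) ⟩
      exts (λ i → ren f (ρ i)) (a ↑ˡ 1) ∎)
    (λ b → trans (cong (ren (ext f)) (exts-↑ʳ ρ b))
                 (trans (cong var (⊗fun-↑ʳ (fun f) _ b)) (sym (exts-↑ʳ (λ i → ren f (ρ i)) b))))
    where open ≡-Reasoning

  ren-exts^ : ∀ k {n m o} (f : Inj m o) (ρ : Subst n m) →
              (λ i → ren (ext^ k f) (exts^ k ρ i)) ≗ exts^ k (λ i → ren f (ρ i))
  ren-exts^ ℕ.zero f ρ i = refl
  ren-exts^ (ℕ.suc k) f ρ i = trans (ren-exts^ k (ext f) (exts ρ) i) (exts^-cong k (ren-exts f ρ) i)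

  mutual
    ren-sub : ∀ {n m o} (f : Inj m o) (ρ : Subst n m) (t : Tm n) → ren f (sub ρ t) ≡ sub (λ i → ren f (ρ i)) t
    ren-sub f ρ (var i) = refl
    ren-sub f ρ (op ω ts) = cong (op ω) (renArgs-subArgs f ρ ts)

    renArgs-subArgs : ∀ {ks n m o} (f : Inj m o) (ρ : Subst n m) (ts : Args ks n) →
                      renArgs f (subArgs ρ ts) ≡ subArgs (λ i → ren f (ρ i)) ts
    renArgs-subArgs f ρ [] = refl
    renArgs-subArgs f ρ (_∷_ {k} t ts) =
      cong₂ _∷_ (trans (ren-sub (ext^ k f) (exts^ k ρ) t) (sub-cong (ren-exts^ k f ρ) t)) (renArgs-subArgs f ρ ts)

  sub-exts : ∀ {n m o} (τ : Subst m o) (ρ : Subst n m) → (λ i → sub (exts τ) (exts ρ i)) ≗ exts (λ i → sub τ (ρ i))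
  sub-exts τ ρ = ++-pointwise
    (λ a → begin
      sub (exts τ) (exts ρ (a ↑ˡ 1))          ≡⟨ cong (sub (exts τ)) (exts-↑ˡ ρ a) ⟩
      sub (exts τ) (ren wk (ρ a))             ≡⟨ sub-ren (exts τ) wk (ρ a) ⟩
      sub (λ i → exts τ (i ↑ˡ 1)) (ρ a)       ≡⟨ sub-cong (exts-↑ˡ τ) (ρ a) ⟩
      sub (λ i → ren wk (τ i)) (ρ a)          ≡⟨ sym (ren-sub wk τ (ρ a)) ⟩
      ren wk (sub τ (ρ a))                    ≡⟨ sym (exts-↑ˡ (λ i → sub τ (ρ i)) a) ⟩
      exts (λ i → sub τ (ρ i)) (a ↑ˡ 1)       ∎)
    (λ b → trans (cong (sub (exts τ)) (exts-↑ʳ ρ b)) (trans (exts-↑ʳ τ b) (sym (exts-↑ʳ (λ i → sub τ (ρ i)) b))))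
    where open ≡-Reasoning

  sub-exts^ : ∀ k {n m o} (τ : Subst m o) (ρ : Subst n m) →
              (λ i → sub (exts^ k τ) (exts^ k ρ i)) ≗ exts^ k (λ i → sub τ (ρ i))
  sub-exts^ ℕ.zero τ ρ i = refl
  sub-exts^ (ℕ.suc k) τ ρ i = trans (sub-exts^ k (exts τ) (exts ρ) i) (exts^-cong k (sub-exts τ ρ) i)

  mutual
    sub-sub : ∀ {n m o} (τ : Subst m o) (ρ : Subst n m) (t : Tm n) → sub τ (sub ρ t) ≡ sub (λ i → sub τ (ρ i)) t
    sub-sub τ ρ (var i) = refl
    sub-sub τ ρ (op ω ts) = cong (op ω) (subArgs-subArgs τ ρ ts)

    subArgs-subArgs : ∀ {ks n m o} (τ : Subst m o) (ρ : Subst n m) (ts : Args ks n) →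
                      subArgs τ (subArgs ρ ts) ≡ subArgs (λ i → sub τ (ρ i)) ts
    subArgs-subArgs τ ρ [] = refl
    subArgs-subArgs τ ρ (_∷_ {k} t ts) =
      cong₂ _∷_ (trans (sub-sub (exts^ k τ) (exts^ k ρ) t) (sub-cong (sub-exts^ k τ ρ) t)) (subArgs-subArgs τ ρ ts)

  exts-var : ∀ {n m} (f : Inj n m) → exts (λ i → var (fun f i)) ≗ (λ i → var (fun (ext f) i))
  exts-var f = ++-pointwise
    (λ a → trans (exts-↑ˡ (λ i → var (fun f i)) a) (cong var (sym (⊗fun-↑ˡ (fun f) _ a))))
    (λ b → trans (exts-↑ʳ (λ i → var (fun f i)) b) (cong var (sym (⊗fun-↑ʳ (fun f) _ b))))

  exts^-var : ∀ k {n m} (f : Inj n m) → exts^ k (λ i → var (fun f i)) ≗ (λ i → var (fun (ext^ k f) i))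
  exts^-var ℕ.zero f i = refl
  exts^-var (ℕ.suc k) f i = trans (exts^-cong k (exts-var f) i) (exts^-var k (ext f) i)

  mutual
    sub-var : ∀ {n m} (f : Inj n m) (t : Tm n) → sub (λ i → var (fun f i)) t ≡ ren f t
    sub-var f (var i) = refl
    sub-var f (op ω ts) = cong (op ω) (subArgs-var f ts)

    subArgs-var : ∀ {ks n m} (f : Inj n m) (ts : Args ks n) → subArgs (λ i → var (fun f i)) ts ≡ renArgs f ts
    subArgs-var f [] = refl
    subArgs-var f (_∷_ {k} t ts) =
      cong₂ _∷_ (trans (sub-cong (exts^-var k f) t) (sub-var (ext^ k f) t)) (subArgs-var f ts)

  -- Free variables and affine terms

  mutual
    Occurs : ∀ {n} → Fin n → Tm n → Set
    Occurs i (var j) = i ≡ j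
    Occurs i (op ω ts) = OccursArgs i ts

    OccursArgs : ∀ {ks n} → Fin n → Args ks n → Set
    OccursArgs i [] = ⊥
    OccursArgs i (_∷_ {k} t ts) = Occurs (wk^ k i) t ⊎ OccursArgs i ts

  mutual
    occurs? : ∀ {n} (i : Fin n) (t : Tm n) → Dec (Occurs i t)
    occurs? i (var j) = i ≟ j
    occurs? i (op ω ts) = occursArgs? i ts

    occursArgs? : ∀ {ks n} (i : Fin n) (ts : Args ks n) → Dec (OccursArgs i ts)
    occursArgs? i [] = no λ ()
    occursArgs? i (_∷_ {k} t ts) = occurs? (wk^ k i) t ⊎-dec occursArgs? i ts

  ext-inv : ∀ {n m} (f : Inj n m) (j : Fin m) x →
            fun (ext f) x ≡ j ↑ˡ 1 → ∃ λ i → x ≡ i ↑ˡ 1 × fun f i ≡ j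
  ext-inv f j = ↑-ind _
    (λ a e → a , refl , ↑ˡ-injective 1 _ _ (trans (sym (⊗fun-↑ˡ (fun f) _ a)) e))
    (λ b e → ⊥-elim (↑ˡ≢↑ʳ j b (sym (trans (sym (⊗fun-↑ʳ (fun f) _ b)) e))))

  ext^-inv : ∀ k {n m} (f : Inj n m) (j : Fin m) x →
             fun (ext^ k f) x ≡ wk^ k j → ∃ λ i → x ≡ wk^ k i × fun f i ≡ j
  ext^-inv ℕ.zero f j x e = x , refl , e
  ext^-inv (ℕ.suc k) f j x e with ext^-inv k (ext f) (j ↑ˡ 1) x e
  ... | _ , refl , e′ with ext-inv f j _ e′
  ... | i , refl , e″ = i , refl , e″

  ext^-onto : ∀ k {n m} (f : Inj m n) x →
              (∀ i → wk^ k i ≡ x → ∃ λ j → fun f j ≡ i) → ∃ λ y → fun (ext^ k f) y ≡ x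
  ext^-onto ℕ.zero f x onto = onto x refl
  ext^-onto (ℕ.suc k) {n} {m} f x onto = ext^-onto k (ext f) x (↑-ind _ onˡ onʳ)
    where
    onˡ : ∀ a → wk^ k (a ↑ˡ 1) ≡ x → ∃ λ j → fun (ext f) j ≡ a ↑ˡ 1
    onˡ a e = let (j , e′) = onto a e in j ↑ˡ 1 , trans (⊗fun-↑ˡ (fun f) _ j) (cong (_↑ˡ 1) e′)
    onʳ : ∀ b → wk^ k (n ↑ʳ b) ≡ x → ∃ λ j → fun (ext f) j ≡ n ↑ʳ b
    onʳ b _ = m ↑ʳ b , ⊗fun-↑ʳ (fun f) _ b

  mutual
    occurs-ren : ∀ {n m} (f : Inj n m) (t : Tm n) i → Occurs i t → Occurs (fun f i) (ren f t)
    occurs-ren f (var j) i o = cong (fun f) o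
    occurs-ren f (op ω ts) i o = occursArgs-renArgs f ts i o

    occurs-ren-ext^ : ∀ k {n m} (f : Inj n m) (t : Tm (lift k n)) i →
                      Occurs (wk^ k i) t → Occurs (wk^ k (fun f i)) (ren (ext^ k f) t)
    occurs-ren-ext^ k f t i o =
      subst (λ z → Occurs z (ren (ext^ k f) t)) (ext^-wk^ k f i) (occurs-ren (ext^ k f) t (wk^ k i) o)

    occursArgs-renArgs : ∀ {ks n m} (f : Inj n m) (ts : Args ks n) i →
                         OccursArgs i ts → OccursArgs (fun f i) (renArgs f ts)
    occursArgs-renArgs f (_∷_ {k} t ts) i (inj₁ o) = inj₁ (occurs-ren-ext^ k f t i o)
    occursArgs-renArgs f (t ∷ ts) i (inj₂ o) = inj₂ (occursArgs-renArgs f ts i o)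

  mutual
    occurs-ren⁻ : ∀ {n m} (f : Inj n m) (t : Tm n) j →
                  Occurs j (ren f t) → ∃ λ i → fun f i ≡ j × Occurs i t
    occurs-ren⁻ f (var i) j o = i , sym o , refl
    occurs-ren⁻ f (op ω ts) j o = occursArgs-renArgs⁻ f ts j o

    occursArgs-renArgs⁻ : ∀ {ks n m} (f : Inj n m) (ts : Args ks n) j → OccursArgs j (renArgs f ts) →
                          ∃ λ i → fun f i ≡ j × OccursArgs i ts
    occursArgs-renArgs⁻ f (_∷_ {k} t ts) j (inj₁ o) with occurs-ren⁻ (ext^ k f) t (wk^ k j) o
    ... | x , e , o′ with ext^-inv k f j x e
    ... | i , refl , e′ = i , e′ , inj₁ o′
    occursArgs-renArgs⁻ f (t ∷ ts) j (inj₂ o) with occursArgs-renArgs⁻ f ts j o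
    ... | i , e , o′ = i , e , inj₂ o′

  exts-inv : ∀ {n m} (ρ : Subst n m) z x →
             Occurs (z ↑ˡ 1) (exts ρ x) → ∃ λ i → x ≡ i ↑ˡ 1 × Occurs z (ρ i)
  exts-inv {m = m} ρ z = ↑-ind _
    (λ a o → let (y , e , o′) = occurs-ren⁻ wk (ρ a) (z ↑ˡ 1) (subst (Occurs (z ↑ˡ 1)) (exts-↑ˡ ρ a) o)
             in a , refl , subst (λ q → Occurs q (ρ a)) (↑ˡ-injective 1 y z e) o′)
    (λ b o → ⊥-elim (↑ˡ≢↑ʳ z b (subst (Occurs (z ↑ˡ 1)) (exts-↑ʳ ρ b) o)))

  exts^-inv : ∀ k {n m} (ρ : Subst n m) z x →
              Occurs (wk^ k z) (exts^ k ρ x) → ∃ λ i → x ≡ wk^ k i × Occurs z (ρ i)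
  exts^-inv ℕ.zero ρ z x o = x , refl , o
  exts^-inv (ℕ.suc k) ρ z x o with exts^-inv k (exts ρ) (z ↑ˡ 1) x o
  ... | _ , refl , o′ with exts-inv ρ z _ o′
  ... | i , refl , o″ = i , refl , o″

  mutual
    occurs-sub⁻ : ∀ {n m} (ρ : Subst n m) (t : Tm n) z →
                  Occurs z (sub ρ t) → ∃ λ x → Occurs x t × Occurs z (ρ x)
    occurs-sub⁻ ρ (var i) z o = i , refl , o
    occurs-sub⁻ ρ (op ω ts) z o = occursArgs-subArgs⁻ ρ ts z o

    occursArgs-subArgs⁻ : ∀ {ks n m} (ρ : Subst n m) (ts : Args ks n) z → OccursArgs z (subArgs ρ ts) →
                          ∃ λ x → OccursArgs x ts × Occurs z (ρ x)
    occursArgs-subArgs⁻ ρ (_∷_ {k} t ts) z (inj₁ o) with occurs-sub⁻ (exts^ k ρ) t (wk^ k z) o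
    ... | x , o′ , o″ with exts^-inv k ρ z x o″
    ... | i , refl , o‴ = i , inj₁ o′ , o‴
    occursArgs-subArgs⁻ ρ (t ∷ ts) z (inj₂ o) with occursArgs-subArgs⁻ ρ ts z o
    ... | i , o′ , o″ = i , inj₂ o′ , o″

  mutual
    Affine : ∀ {n} → Tm n → Set
    Affine (var i) = ⊤
    Affine (op ω ts) = AffineArgs ts

    AffineArgs : ∀ {ks n} → Args ks n → Set
    AffineArgs [] = ⊤
    AffineArgs (_∷_ {k} t ts) = Affine t × AffineArgs ts × (∀ i → Occurs (wk^ k i) t → OccursArgs i ts → ⊥)

  mutual
    affine-ren : ∀ {n m} (f : Inj n m) (t : Tm n) → Affine t → Affine (ren f t)
    affine-ren f (var i) a = tt
    affine-ren f (op ω ts) a = affineArgs-renArgs f ts a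

    affineArgs-renArgs : ∀ {ks n m} (f : Inj n m) (ts : Args ks n) →
                         AffineArgs ts → AffineArgs (renArgs f ts)
    affineArgs-renArgs f [] a = tt
    affineArgs-renArgs f (_∷_ {k} t ts) (a , as , disjoint) =
      affine-ren (ext^ k f) t a , affineArgs-renArgs f ts as , disjoint′
      where
      disjoint′ : ∀ i → Occurs (wk^ k i) (ren (ext^ k f) t) → OccursArgs i (renArgs f ts) → ⊥
      disjoint′ i o o′ with occurs-ren⁻ (ext^ k f) t (wk^ k i) o | occursArgs-renArgs⁻ f ts i o′
      ... | x , e , ox | i₂ , refl , o₂ with ext^-inv k f (fun f i₂) x e
      ... | i₁ , refl , e₁ with inj f e₁
      ... | refl = disjoint i₁ ox o₂

  record AffineSubst {n m} (ρ : Subst n m) : Set where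
    field
      affine    : ∀ i → Affine (ρ i)
      separated : ∀ i i′ z → Occurs z (ρ i) → Occurs z (ρ i′) → i ≡ i′
  open AffineSubst

  var-affineSubst : ∀ {n m} (f : Inj n m) → AffineSubst (λ i → var (fun f i))
  var-affineSubst f = record { affine = λ _ → tt ; separated = λ i i′ z e e′ → inj f (trans (sym e) e′) }

  ren-affineSubst : ∀ {n m o} (f : Inj m o) {ρ : Subst n m} →
                    AffineSubst ρ → AffineSubst (λ i → ren f (ρ i))
  ren-affineSubst f {ρ} aρ = record
    { affine = λ i → affine-ren f (ρ i) (affine aρ i)
    ; separated = λ i i′ z o o′ → sep i i′ z (occurs-ren⁻ f (ρ i) z o) (occurs-ren⁻ f (ρ i′) z o′) }
    where
    sep : ∀ i i′ z → (∃ λ y → fun f y ≡ z × Occurs y (ρ i)) →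
                     (∃ λ y → fun f y ≡ z × Occurs y (ρ i′)) → i ≡ i′
    sep i i′ z (y , refl , o) (y′ , e′ , o′) with inj f e′
    ... | refl = separated aρ i i′ y o o′

  const-affineSubst : ∀ {m} {t : Tm m} → Affine t → AffineSubst {1} (λ _ → t)
  const-affineSubst a = record { affine = λ _ → a ; separated = λ i i′ _ _ _ → Fin1-≡ i i′ }

  ++-affineSubst : ∀ {a b m} {σ : Subst a m} {τ : Subst b m} → AffineSubst σ → AffineSubst τ →
                   (∀ x y z → Occurs z (σ x) → Occurs z (τ y) → ⊥) → AffineSubst (σ ++ τ)
  ++-affineSubst {a} {b} {σ = σ} {τ} aσ aτ disjoint = record { affine = aff ; separated = sep }
    where
    aff : ∀ i → Affine ((σ ++ τ) i)
    aff = ↑-ind _ (λ x → subst Affine (sym (lookup-++ˡ σ τ x)) (affine aσ x))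
                  (λ y → subst Affine (sym (lookup-++ʳ σ τ y)) (affine aτ y))
    atˡ : ∀ {z} x → Occurs z ((σ ++ τ) (x ↑ˡ b)) → Occurs z (σ x)
    atˡ {z} x = subst (Occurs z) (lookup-++ˡ σ τ x)
    atʳ : ∀ {z} y → Occurs z ((σ ++ τ) (a ↑ʳ y)) → Occurs z (τ y)
    atʳ {z} y = subst (Occurs z) (lookup-++ʳ σ τ y)
    sep : ∀ i i′ z → Occurs z ((σ ++ τ) i) → Occurs z ((σ ++ τ) i′) → i ≡ i′
    sep i i′ z = ↑-ind (λ i → Occurs z ((σ ++ τ) i) → Occurs z ((σ ++ τ) i′) → i ≡ i′)
      (λ x o → ↑-ind (λ i′ → Occurs z ((σ ++ τ) i′) → x ↑ˡ b ≡ i′)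
        (λ x′ o′ → cong (_↑ˡ b) (separated aσ x x′ z (atˡ x o) (atˡ x′ o′)))
        (λ y′ o′ → ⊥-elim (disjoint x y′ z (atˡ x o) (atʳ y′ o′))) i′)
      (λ y o → ↑-ind (λ i′ → Occurs z ((σ ++ τ) i′) → a ↑ʳ y ≡ i′)
        (λ x′ o′ → ⊥-elim (disjoint x′ y z (atˡ x′ o′) (atʳ y o)))
        (λ y′ o′ → cong (a ↑ʳ_) (separated aτ y y′ z (atʳ y o) (atʳ y′ o′))) i′) i

  exts-affineSubst : ∀ {n m} {ρ : Subst n m} → AffineSubst ρ → AffineSubst (exts ρ)
  exts-affineSubst {m = m} {ρ} aρ = ++-affineSubst (ren-affineSubst wk aρ) (var-affineSubst (inclR m)) disjoint
    where
    disjoint : ∀ x y z → Occurs z (ren wk (ρ x)) → Occurs z (var (m ↑ʳ y)) → ⊥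
    disjoint x y z o refl with occurs-ren⁻ wk (ρ x) _ o
    ... | w , e , _ = ↑ˡ≢↑ʳ w y e

  exts^-affineSubst : ∀ k {n m} {ρ : Subst n m} → AffineSubst ρ → AffineSubst (exts^ k ρ)
  exts^-affineSubst ℕ.zero aρ = aρ
  exts^-affineSubst (ℕ.suc k) aρ = exts^-affineSubst k (exts-affineSubst aρ)

  mutual
    affine-sub : ∀ {n m} {ρ : Subst n m} → AffineSubst ρ → (t : Tm n) → Affine t → Affine (sub ρ t)
    affine-sub aρ (var i) a = affine aρ i
    affine-sub aρ (op ω ts) a = affineArgs-subArgs aρ ts a

    affineArgs-subArgs : ∀ {ks n m} {ρ : Subst n m} → AffineSubst ρ →
                         (ts : Args ks n) → AffineArgs ts → AffineArgs (subArgs ρ ts)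
    affineArgs-subArgs aρ [] a = tt
    affineArgs-subArgs {ρ = ρ} aρ (_∷_ {k} t ts) (a , as , disjoint) =
      affine-sub (exts^-affineSubst k aρ) t a , affineArgs-subArgs aρ ts as , disjoint′
      where
      disjoint′ : ∀ i → Occurs (wk^ k i) (sub (exts^ k ρ) t) → OccursArgs i (subArgs ρ ts) → ⊥
      disjoint′ i o o′ with occurs-sub⁻ (exts^ k ρ) t (wk^ k i) o | occursArgs-subArgs⁻ ρ ts i o′
      ... | x , ox , oρ | i₂ , o₂ , oρ₂ with exts^-inv k ρ i x oρ
      ... | i₁ , refl , oρ₁ with separated aρ i₁ i₂ i oρ₁ oρ₂
      ... | refl = disjoint i₁ ox o₂

  ren-ext^-∘ : ∀ k {n m o} (g : Inj m o) (f : Inj n m) (t : Tm (lift k n)) →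
               ren (ext^ k g) (ren (ext^ k f) t) ≡ ren (ext^ k (g ∘I f)) t
  ren-ext^-∘ k g f t = sym (trans (ren-cong (ext^-∘ k g f) t) (ren-∘ (ext^ k g) (ext^ k f) t))

  juxtapose : ∀ k {ks m₁ m₂ n} → Inj (m₁ + m₂) n → Tm (lift k m₁) → Args ks m₂ → Args (k ∷ ks) n
  juxtapose k {m₁ = m₁} {m₂} j t ts = ren (ext^ k (j ∘I inclL m₂)) t ∷ renArgs (j ∘I inclR m₁) ts

  juxtapose-affine : ∀ k {ks m₁ m₂ n} (j : Inj (m₁ + m₂) n) {t : Tm (lift k m₁)} {ts : Args ks m₂} →
                     Affine t → AffineArgs ts → AffineArgs (juxtapose k j t ts)
  juxtapose-affine k {m₁ = m₁} {m₂} j {t} {ts} a as =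
    affine-ren (ext^ k (j ∘I inclL m₂)) t a , affineArgs-renArgs (j ∘I inclR m₁) ts as , disjoint
    where
    disjoint : ∀ i → Occurs (wk^ k i) (ren (ext^ k (j ∘I inclL m₂)) t) →
                     OccursArgs i (renArgs (j ∘I inclR m₁) ts) → ⊥
    disjoint i o o′ with occurs-ren⁻ (ext^ k (j ∘I inclL m₂)) t (wk^ k i) o
                       | occursArgs-renArgs⁻ (j ∘I inclR m₁) ts i o′
    ... | x , e , _ | b , e₂ , _ with ext^-inv k (j ∘I inclL m₂) i x e
    ... | a′ , refl , e₁ = ↑ˡ≢↑ʳ a′ b (inj j (trans e₁ (sym e₂)))

  AffTm : Psh
  AffTm = record
    { Ob = λ n → Σ (Tm n) Affine
    ; Eq = λ t u → proj₁ t ≡ proj₁ u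
    ; isEquiv = record { refl = refl ; sym = sym ; trans = trans }
    ; act = λ f t → ren f (proj₁ t) , affine-ren f (proj₁ t) (proj₂ t)
    ; act-cong = λ {_} {_} {f} {g} {t} {u} p q → trans (cong (ren f) q) (ren-cong p (proj₁ u))
    ; act-id = λ t → ren-id (proj₁ t)
    ; act-∘ = λ g f t → ren-∘ g f (proj₁ t)
    }

  flatten : ∀ ks {n} → Ob (SigProd AffTm ks) n → Σ (Args ks n) AffineArgs
  flatten [] _ = [] , tt
  flatten (k ∷ []) x = let (t , a) = out^ AffTm k x in t ∷ [] , a , tt , λ _ _ ()
  flatten (k ∷ k′ ∷ ks) (⟦_,_,_⟧ {m₁} {m₂} x y j) =
    let (t , a) = out^ AffTm k x ; (ts , as) = flatten (k′ ∷ ks) y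
    in juxtapose k j t ts , juxtapose-affine k j {t} a as

  flattenArgs : ∀ ks {n} → Ob (SigProd AffTm ks) n → Args ks n
  flattenArgs ks D = proj₁ (flatten ks D)

  flatten-act : ∀ ks {m n} (f : Inj m n) (D : Ob (SigProd AffTm ks) m) →
                flattenArgs ks (act (SigProd AffTm ks) f D) ≡ renArgs f (flattenArgs ks D)
  flatten-act [] f D = refl
  flatten-act (k ∷ []) f x = cong (λ t → proj₁ t ∷ []) (out^-act AffTm k f x)
  flatten-act (k ∷ k′ ∷ ks) f (⟦_,_,_⟧ {m₁} {m₂} x y j) =
    cong₂ _∷_ (sym (ren-ext^-∘ k f (j ∘I inclL m₂) _)) (renArgs-∘ f (j ∘I inclR m₁) _)

  flatten-cong : ∀ ks {n} {D D′ : Ob (SigProd AffTm ks) n} →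
                 Eq (SigProd AffTm ks) D D′ → flattenArgs ks D ≡ flattenArgs ks D′
  flatten-cong [] p = refl
  flatten-cong (k ∷ []) p = cong (_∷ []) (out^-cong AffTm k p)
  flatten-cong (k ∷ k′ ∷ ks) =
    gfold isEquivalence (flattenArgs (k ∷ k′ ∷ ks)) (generator (flatten-cong (k′ ∷ ks)))
    where
    generator : (∀ {n} {E E′ : Ob (SigProd AffTm (k′ ∷ ks)) n} → Eq (SigProd AffTm (k′ ∷ ks)) E E′ →
                  flattenArgs (k′ ∷ ks) E ≡ flattenArgs (k′ ∷ ks) E′) →
                ∀ {n} {D D′ : DayEl (δ^ k AffTm) (SigProd AffTm (k′ ∷ ks)) n} → DayGen _ _ D D′ →
                flattenArgs (k ∷ k′ ∷ ks) D ≡ flattenArgs (k ∷ k′ ∷ ks) D′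
    generator _ (coend {m₁} {m₁′} {m₂} {m₂′} g h x y K K′ p) = cong₂ _∷_
      (begin
        ren (ext^ k (K ∘I inclL m₂′)) (proj₁ (out^ AffTm k (act (δ^ k AffTm) g x)))
          ≡⟨ cong (λ t → ren (ext^ k (K ∘I inclL m₂′)) (proj₁ t)) (out^-act AffTm k g x) ⟩
        ren (ext^ k (K ∘I inclL m₂′)) (ren (ext^ k g) (proj₁ (out^ AffTm k x)))
          ≡⟨ ren-ext^-∘ k (K ∘I inclL m₂′) g _ ⟩
        ren (ext^ k (K ∘I inclL m₂′ ∘I g)) (proj₁ (out^ AffTm k x))
          ≡⟨ ren-cong (ext^-cong k (coend-inclL g h K K′ p)) _ ⟩
        ren (ext^ k (K′ ∘I inclL m₂)) (proj₁ (out^ AffTm k x)) ∎)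
      (begin
        renArgs (K ∘I inclR m₁′) (flattenArgs (k′ ∷ ks) (act (SigProd AffTm (k′ ∷ ks)) h y))
          ≡⟨ cong (renArgs (K ∘I inclR m₁′)) (flatten-act (k′ ∷ ks) h y) ⟩
        renArgs (K ∘I inclR m₁′) (renArgs h (flattenArgs (k′ ∷ ks) y))
          ≡⟨ sym (renArgs-∘ (K ∘I inclR m₁′) h _) ⟩
        renArgs (K ∘I inclR m₁′ ∘I h) (flattenArgs (k′ ∷ ks) y)
          ≡⟨ renArgs-cong (coend-inclR g h K K′ p) _ ⟩
        renArgs (K′ ∘I inclR m₁) (flattenArgs (k′ ∷ ks) y) ∎)
      where open ≡-Reasoning
    generator IH (resp {m₁} {m₂} {k = K} {k' = K′} px py pK) = cong₂ _∷_
      (trans (cong (ren (ext^ k (K ∘I inclL m₂))) (out^-cong AffTm k px))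
             (ren-cong (ext^-cong k λ a → pK (a ↑ˡ m₂)) _))
      (trans (cong (renArgs (K ∘I inclR m₁)) (IH py)) (renArgs-cong (λ b → pK (m₁ ↑ʳ b)) _))

  varAlg : Hom V AffTm
  varAlg = record
    { hom = λ v → var (fun v zero) , tt
    ; hom-cong = λ p → cong var (p zero)
    ; nat = λ f v → refl
    }

  opAlg : Hom (SigF S AffTm) AffTm
  opAlg = record
    { hom = λ { (ω , D) → op ω (flattenArgs (ar S ω) D) , proj₂ (flatten (ar S ω) D) }
    ; hom-cong = λ { (coinj {ω} p) → cong (op ω) (flatten-cong (ar S ω) p) }
    ; nat = λ { f (ω , D) → cong (op ω) (flatten-act (ar S ω) f D) }
    }

  -- Substitution for the last variable

  plug : ∀ {m₁ m₂ n} → Inj (m₁ + m₂) n → Tm m₂ → Subst (m₁ + 1) n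
  plug {m₁} {m₂} K u = (λ a → var (fun K (a ↑ˡ m₂))) ++ (λ _ → ren (K ∘I inclR m₁) u)

  module _ {m₁ m₂ n} (K : Inj (m₁ + m₂) n) (u : Tm m₂) where

    plug-↑ˡ : ∀ a → plug K u (a ↑ˡ 1) ≡ var (fun K (a ↑ˡ m₂))
    plug-↑ˡ = lookup-++ˡ (λ a → var (fun K (a ↑ˡ m₂))) (λ _ → ren (K ∘I inclR m₁) u)

    plug-↑ʳ : ∀ b → plug K u (m₁ ↑ʳ b) ≡ ren (K ∘I inclR m₁) u
    plug-↑ʳ = lookup-++ʳ (λ a → var (fun K (a ↑ˡ m₂))) (λ _ → ren (K ∘I inclR m₁) u)

    plug-affineSubst : Affine u → AffineSubst (plug K u)
    plug-affineSubst a =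
      ++-affineSubst (var-affineSubst (K ∘I inclL m₂)) (const-affineSubst (affine-ren (K ∘I inclR m₁) u a)) disjoint
      where
      disjoint : ∀ x y z → Occurs z (var (fun K (x ↑ˡ m₂))) → Occurs z (ren (K ∘I inclR m₁) u) → ⊥
      disjoint x y z refl o with occurs-ren⁻ (K ∘I inclR m₁) u _ o
      ... | c , e , _ = ↑ˡ≢↑ʳ x c (inj K (sym e))

    ren-plug : ∀ {n′} (f : Inj n n′) i → ren f (plug K u i) ≡ plug (f ∘I K) u i
    ren-plug f = ++-pointwise
      (λ a → trans (cong (ren f) (plug-↑ˡ a)) (sym (plug-↑ˡ′ a)))
      (λ b → trans (cong (ren f) (plug-↑ʳ b)) (trans (sym (ren-∘ f (K ∘I inclR m₁) u)) (sym (plug-↑ʳ′ b))))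
      where
      plug-↑ˡ′ = lookup-++ˡ (λ a → var (fun (f ∘I K) (a ↑ˡ m₂))) (λ _ → ren ((f ∘I K) ∘I inclR m₁) u)
      plug-↑ʳ′ = lookup-++ʳ (λ a → var (fun (f ∘I K) (a ↑ˡ m₂))) (λ _ → ren ((f ∘I K) ∘I inclR m₁) u)

  plug-cong : ∀ {m₁ m₂ n} {K K′ : Inj (m₁ + m₂) n} (u : Tm m₂) → K ≈I K′ → plug K u ≗ plug K′ u
  plug-cong {m₁} {m₂} {K = K} {K′} u p = ++-pointwise
    (λ a → trans (plug-↑ˡ K u a) (trans (cong var (p (a ↑ˡ m₂))) (sym (plug-↑ˡ K′ u a))))
    (λ b → trans (plug-↑ʳ K u b) (trans (ren-cong (λ c → p (m₁ ↑ʳ c)) u) (sym (plug-↑ʳ K′ u b))))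

  plug-ext : ∀ {m₁ m₁′ m₂ m₂′ n} (g : Inj m₁ m₁′) (h : Inj m₂ m₂′) (K : Inj (m₁′ + m₂′) n) (K′ : Inj (m₁ + m₂) n)
             (u : Tm m₂) →
             K′ ≈I (K ∘I (g ⊗I h)) → (λ i → plug K (ren h u) (fun (ext g) i)) ≗ plug K′ u
  plug-ext {m₁} {m₁′} {m₂} {m₂′} g h K K′ u p = ++-pointwise
    (λ a → begin
      plug K (ren h u) (fun (ext g) (a ↑ˡ 1)) ≡⟨ cong (plug K (ren h u)) (⊗fun-↑ˡ (fun g) (λ i → i) a) ⟩
      plug K (ren h u) (fun g a ↑ˡ 1)         ≡⟨ plug-↑ˡ K (ren h u) (fun g a) ⟩
      var (fun K (fun g a ↑ˡ m₂′))            ≡⟨ cong var (coend-inclL g h K K′ p a) ⟩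
      var (fun K′ (a ↑ˡ m₂))                  ≡⟨ sym (plug-↑ˡ K′ u a) ⟩
      plug K′ u (a ↑ˡ 1)                      ∎)
    (λ b → begin
      plug K (ren h u) (fun (ext g) (m₁ ↑ʳ b)) ≡⟨ cong (plug K (ren h u)) (⊗fun-↑ʳ (fun g) (λ i → i) b) ⟩
      plug K (ren h u) (m₁′ ↑ʳ b)              ≡⟨ plug-↑ʳ K (ren h u) b ⟩
      ren (K ∘I inclR m₁′) (ren h u)           ≡⟨ sym (ren-∘ (K ∘I inclR m₁′) h u) ⟩
      ren (K ∘I inclR m₁′ ∘I h) u              ≡⟨ ren-cong (coend-inclR g h K K′ p) u ⟩
      ren (K′ ∘I inclR m₁) u                   ≡⟨ sym (plug-↑ʳ K′ u b) ⟩
      plug K′ u (m₁ ↑ʳ b)                      ∎)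
    where open ≡-Reasoning

  substTm : ∀ {n} → DayEl (δ AffTm) AffTm n → Ob AffTm n
  substTm ⟦ (t , a) , (u , b) , K ⟧ = sub (plug K u) t , affine-sub (plug-affineSubst K u b) t a

  substAlg : Hom (δ AffTm ⊗̂ AffTm) AffTm
  substAlg = record
    { hom = substTm
    ; hom-cong = gfold isEquivalence (λ d → proj₁ (substTm d)) generator
    ; nat = λ { f ⟦ (t , _) , (u , _) , K ⟧ → sym (trans (ren-sub f (plug K u) t) (sub-cong (ren-plug K u f) t)) }
    }
    where
    generator : ∀ {n} {d d′ : DayEl (δ AffTm) AffTm n} → DayGen _ _ d d′ → proj₁ (substTm d) ≡ proj₁ (substTm d′)
    generator (coend g h t u K K′ p) =
      trans (sub-ren (plug K (ren h (proj₁ u))) (ext g) (proj₁ t)) (sub-cong (plug-ext g h K K′ (proj₁ u) p) (proj₁ t))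
    generator (resp {x' = t′} {y' = u′} {k = K} {k' = K′} pt pu pK) =
      trans (cong₂ (λ u t → sub (plug K u) t) pu pt) (sub-cong (plug-cong {K = K} {K′} (proj₁ u′) pK) (proj₁ t′))

  plug-up : ∀ {m₁ m₂ n} (K : Inj (m₁ + m₂) n) (u : Tm m₂) →
            (λ a → plug K u (fun upInj a)) ≗ (λ a → var (fun (K ∘I inclL m₂) a))
  plug-up K u a = trans (cong (plug K u) (fun-upInj a)) (plug-↑ˡ K u a)

  plug-strL-last : ∀ {m₁ m₂ n} (K : Inj (m₁ + m₂) n) →
                   plug {m₁} (strLInj {m₁} {m₂} K) (var (m₂ ↑ʳ zero)) ≗ (λ i → var (fun (ext (K ∘I inclL m₂)) i))
  plug-strL-last {m₁} {m₂} {n} K = ++-pointwise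
    (λ a → trans (plug-↑ˡ {m₁} (strLInj {m₁} {m₂} K) _ a)
                 (cong var (trans (strLInj-↑ˡ {m₁} {m₂} K a) (sym (⊗fun-↑ˡ (fun (K ∘I inclL m₂)) (λ i → i) a)))))
    (λ b → trans (plug-↑ʳ {m₁} (strLInj {m₁} {m₂} K) _ b)
                 (cong var (trans (strLInj-↑ʳ↑ʳ {m₁} {m₂} K zero)
                                  (trans (cong (n ↑ʳ_) (Fin1-≡ zero b)) (sym (⊗fun-↑ʳ (fun (K ∘I inclL m₂)) (λ i → i) b))))))

  module _ {m₁ m₂ p₁ p₂ n} (g : Inj (m₁ + m₂) n) (f : Inj (p₁ + p₂) m₂) where

    plug-assoc : (y : Tm (p₁ + 1)) (z : Tm p₂) →
                 (λ i → sub (plug {m₁ + p₁} (assocInj {m₁} {m₂} {p₁} {p₂} g f) z) (plug {m₁} (strLInj {m₁} {p₁} idI) y i))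
                 ≗ plug {m₁} g (sub (plug {p₁} f z) y)
    plug-assoc y z = ++-pointwise
      (λ a → begin
        sub ρG (ρK (a ↑ˡ 1)) ≡⟨ cong (sub ρG) (plug-↑ˡ {m₁} K y a) ⟩
        ρG (fun K (a ↑ˡ (p₁ + 1)))   ≡⟨ cong ρG (strLInj-↑ˡ {m₁} {p₁} idI a) ⟩
        ρG ((a ↑ˡ p₁) ↑ˡ 1)                      ≡⟨ plug-↑ˡ {m₁ + p₁} G z (a ↑ˡ p₁) ⟩
        var (fun G ((a ↑ˡ p₁) ↑ˡ p₂))                  ≡⟨ cong var (assocInj-↑ˡ↑ˡ {m₁} {m₂} {p₁} {p₂} g f a) ⟩
        var (fun g (a ↑ˡ m₂))                          ≡⟨ sym (plug-↑ˡ {m₁} g _ a) ⟩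
        plug {m₁} g (sub (plug {p₁} f z) y) (a ↑ˡ 1)             ∎)
      (λ b → begin
        sub ρG (ρK (m₁ ↑ʳ b))        ≡⟨ cong (sub ρG) (plug-↑ʳ {m₁} K y b) ⟩
        sub ρG (ren (K ∘I inclR m₁) y)       ≡⟨ sub-ren (ρG) (K ∘I inclR m₁) y ⟩
        sub (λ j → ρG (fun K (m₁ ↑ʳ j))) y   ≡⟨ sub-cong (++-pointwise onˡ onʳ) y ⟩
        sub (λ j → ren (g ∘I inclR m₁) (plug {p₁} f z j)) y         ≡⟨ sym (ren-sub (g ∘I inclR m₁) (plug {p₁} f z) y) ⟩
        ren (g ∘I inclR m₁) (sub (plug {p₁} f z) y)                 ≡⟨ sym (plug-↑ʳ {m₁} g _ b) ⟩
        plug {m₁} g (sub (plug {p₁} f z) y) (m₁ ↑ʳ b)                    ∎)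
      where
      open ≡-Reasoning
      G = assocInj {m₁} {m₂} {p₁} {p₂} g f
      K : Inj (m₁ + (p₁ + 1)) ((m₁ + p₁) + 1)
      K = strLInj {m₁} {p₁} idI
      ρG = plug {m₁ + p₁} G z
      ρK = plug {m₁} K y
      onˡ : ∀ c → ρG (fun K (m₁ ↑ʳ (c ↑ˡ 1))) ≡ ren (g ∘I inclR m₁) (plug {p₁} f z (c ↑ˡ 1))
      onˡ c = begin
        ρG (fun K (m₁ ↑ʳ (c ↑ˡ 1))) ≡⟨ cong ρG (strLInj-↑ʳ↑ˡ {m₁} {p₁} idI c) ⟩
        ρG ((m₁ ↑ʳ c) ↑ˡ 1)                     ≡⟨ plug-↑ˡ {m₁ + p₁} G z (m₁ ↑ʳ c) ⟩
        var (fun G ((m₁ ↑ʳ c) ↑ˡ p₂))                 ≡⟨ cong var (assocInj-↑ʳ↑ˡ {m₁} {m₂} {p₁} {p₂} g f c) ⟩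
        ren (g ∘I inclR m₁) (var (fun f (c ↑ˡ p₂)))   ≡⟨ cong (ren (g ∘I inclR m₁)) (sym (plug-↑ˡ {p₁} f z c)) ⟩
        ren (g ∘I inclR m₁) (plug {p₁} f z (c ↑ˡ 1))       ∎
      onʳ : ∀ b′ → ρG (fun K (m₁ ↑ʳ (p₁ ↑ʳ b′))) ≡ ren (g ∘I inclR m₁) (plug {p₁} f z (p₁ ↑ʳ b′))
      onʳ b′ = begin
        ρG (fun K (m₁ ↑ʳ (p₁ ↑ʳ b′))) ≡⟨ cong ρG (strLInj-↑ʳ↑ʳ {m₁} {p₁} idI b′) ⟩
        ρG ((m₁ + p₁) ↑ʳ b′)                      ≡⟨ plug-↑ʳ {m₁ + p₁} G z b′ ⟩
        ren (G ∘I inclR (m₁ + p₁)) z                    ≡⟨ ren-cong (assocInj-↑ʳ {m₁} {m₂} {p₁} {p₂} g f) z ⟩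
        ren ((g ∘I inclR m₁) ∘I (f ∘I inclR p₁)) z      ≡⟨ ren-∘ (g ∘I inclR m₁) (f ∘I inclR p₁) z ⟩
        ren (g ∘I inclR m₁) (ren (f ∘I inclR p₁) z)     ≡⟨ cong (ren (g ∘I inclR m₁)) (sym (plug-↑ʳ {p₁} f z b′)) ⟩
        ren (g ∘I inclR m₁) (plug {p₁} f z (p₁ ↑ʳ b′))       ∎

  module _ {m₁ m₂ q₁ q₂ n} (g : Inj (m₁ + m₂) n) (h : Inj (q₁ + q₂) m₂) (u : Tm q₁) (v : Tm q₂) where

    private
      G = assocInj {m₁} {m₂} {q₁} {q₂} g h
      K = strRInj {m₁} {q₁} idI
      ρG = plug {m₁ + q₁} G v
      ρK = plug {m₁ + 1} K u

    plug-strR-↑ˡ↑ˡ : ∀ a → sub ρG (ρK ((a ↑ˡ 1) ↑ˡ 1)) ≡ var (fun g (a ↑ˡ m₂))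
    plug-strR-↑ˡ↑ˡ a = begin
      sub ρG (ρK ((a ↑ˡ 1) ↑ˡ 1))  ≡⟨ cong (sub ρG) (plug-↑ˡ {m₁ + 1} K u (a ↑ˡ 1)) ⟩
      ρG (fun K ((a ↑ˡ 1) ↑ˡ q₁))  ≡⟨ cong ρG (strRInj-↑ˡ↑ˡ {m₁} {q₁} idI a) ⟩
      ρG ((a ↑ˡ q₁) ↑ˡ 1)          ≡⟨ plug-↑ˡ {m₁ + q₁} G v (a ↑ˡ q₁) ⟩
      var (fun G ((a ↑ˡ q₁) ↑ˡ q₂)) ≡⟨ cong var (assocInj-↑ˡ↑ˡ {m₁} {m₂} {q₁} {q₂} g h a) ⟩
      var (fun g (a ↑ˡ m₂))         ∎
      where open ≡-Reasoning

    plug-strR-↑ʳ↑ˡ : ∀ b → sub ρG (ρK ((m₁ ↑ʳ b) ↑ˡ 1)) ≡ ren ((g ∘I inclR m₁) ∘I (h ∘I inclR q₁)) v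
    plug-strR-↑ʳ↑ˡ b = begin
      sub ρG (ρK ((m₁ ↑ʳ b) ↑ˡ 1))  ≡⟨ cong (sub ρG) (plug-↑ˡ {m₁ + 1} K u (m₁ ↑ʳ b)) ⟩
      ρG (fun K ((m₁ ↑ʳ b) ↑ˡ q₁))  ≡⟨ cong ρG (strRInj-↑ʳ↑ˡ {m₁} {q₁} idI b) ⟩
      ρG ((m₁ + q₁) ↑ʳ b)           ≡⟨ plug-↑ʳ {m₁ + q₁} G v b ⟩
      ren (G ∘I inclR (m₁ + q₁)) v  ≡⟨ ren-cong (assocInj-↑ʳ {m₁} {m₂} {q₁} {q₂} g h) v ⟩
      ren ((g ∘I inclR m₁) ∘I (h ∘I inclR q₁)) v ∎
      where open ≡-Reasoning

    plug-strR-↑ʳ : ∀ b → sub ρG (ρK ((m₁ + 1) ↑ʳ b)) ≡ ren ((g ∘I inclR m₁) ∘I (h ∘I inclL q₂)) u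
    plug-strR-↑ʳ b = begin
      sub ρG (ρK ((m₁ + 1) ↑ʳ b))                 ≡⟨ cong (sub ρG) (plug-↑ʳ {m₁ + 1} K u b) ⟩
      sub ρG (ren (K ∘I inclR (m₁ + 1)) u)        ≡⟨ sub-ren ρG (K ∘I inclR (m₁ + 1)) u ⟩
      sub (λ w → ρG (fun K ((m₁ + 1) ↑ʳ w))) u    ≡⟨ sub-cong onVar u ⟩
      sub (λ w → var (fun (g ∘I inclR m₁) (fun h (w ↑ˡ q₂)))) u ≡⟨ sub-var ((g ∘I inclR m₁) ∘I (h ∘I inclL q₂)) u ⟩
      ren ((g ∘I inclR m₁) ∘I (h ∘I inclL q₂)) u  ∎
      where
      open ≡-Reasoning
      onVar : ∀ w → ρG (fun K ((m₁ + 1) ↑ʳ w)) ≡ var (fun (g ∘I inclR m₁) (fun h (w ↑ˡ q₂)))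
      onVar w = trans (cong ρG (strRInj-↑ʳ {m₁} {q₁} idI w))
        (trans (plug-↑ˡ {m₁ + q₁} G v (m₁ ↑ʳ w)) (cong var (assocInj-↑ʳ↑ˡ {m₁} {m₂} {q₁} {q₂} g h w)))

  plug-exchange : ∀ {m₁ m₂ p₁ p₂ n} (g : Inj (m₁ + m₂) n) (f : Inj (p₁ + p₂) m₂) (y : Tm p₁) (z : Tm p₂) →
    (λ i → sub (plug {m₁ + p₁} (assocInj {m₁} {m₂} {p₁} {p₂} g f) z) (plug {m₁ + 1} (strRInj {m₁} {p₁} idI) y i)) ≗
    (λ i → sub (plug {m₁ + p₂} (assocInj {m₁} {m₂} {p₂} {p₁} g (f ∘I blockSwap p₂ p₁)) y)
               (plug {m₁ + 1} (strRInj {m₁} {p₂} idI) z (fun (swapInj {m₁}) i)))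
  plug-exchange {m₁} {m₂} {p₁} {p₂} g f y z = ++-pointwise₃
    (λ a → trans (plug-strR-↑ˡ↑ˡ g f y z a)
                 (sym (trans (cong (sub ρ′ ∘ σ′) (swapInj-↑ˡ↑ˡ a)) (plug-strR-↑ˡ↑ˡ g f′ z y a))))
    (λ b → trans (plug-strR-↑ʳ↑ˡ g f y z b)
                 (sym (trans (cong (sub ρ′ ∘ σ′) (swapInj-↑ʳ↑ˡ b))
                      (trans (plug-strR-↑ʳ g f′ z y b)
                             (ren-cong (λ w → cong (λ i → fun g (m₁ ↑ʳ fun f i)) (blockSwap-↑ˡ p₂ p₁ w)) z)))))
    (λ b → trans (plug-strR-↑ʳ g f y z b)
                 (sym (trans (cong (sub ρ′ ∘ σ′) (swapInj-↑ʳ b))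
                      (trans (plug-strR-↑ʳ↑ˡ g f′ z y b)
                             (ren-cong (λ w → cong (λ i → fun g (m₁ ↑ʳ fun f i)) (blockSwap-↑ʳ p₂ p₁ w)) y)))))
    where
    f′ = f ∘I blockSwap p₂ p₁
    ρ′ = plug {m₁ + p₂} (assocInj {m₁} {m₂} {p₂} {p₁} g f′) y
    σ′ = plug {m₁ + 1} (strRInj {m₁} {p₂} idI) z

  -- Decoding affine terms

  Supported : ∀ {m n} → Inj m n → Tm n → Set
  Supported ι t = ∀ i → Occurs i t → ∃ λ j → fun ι j ≡ i

  SupportedArgs : ∀ {ks m n} → Inj m n → Args ks n → Set
  SupportedArgs ι ts = ∀ i → OccursArgs i ts → ∃ λ j → fun ι j ≡ i

  supported-id : ∀ {n} (t : Tm n) → Supported idI t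
  supported-id t i _ = i , refl

  supportedArgs-id : ∀ {ks n} (ts : Args ks n) → SupportedArgs idI ts
  supportedArgs-id ts i _ = i , refl

  supported-ren : ∀ {m m′ n n′} (t : Tm n) (f : Inj n n′) (ι : Inj m n) (ι′ : Inj m′ n′) (g : Inj m m′) →
                  (ι′ ∘I g) ≈I (f ∘I ι) → Supported ι t → Supported ι′ (ren f t)
  supported-ren t f ι ι′ g sq sp i′ o with occurs-ren⁻ f t i′ o
  ... | i , refl , oi = let (j , e) = sp i oi in fun g j , trans (sq j) (cong (fun f) e)

  supportedArgs-renArgs : ∀ {ks m m′ n n′} (ts : Args ks n) (f : Inj n n′) (ι : Inj m n) (ι′ : Inj m′ n′)
                          (g : Inj m m′) →
                          (ι′ ∘I g) ≈I (f ∘I ι) → SupportedArgs ι ts → SupportedArgs ι′ (renArgs f ts)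
  supportedArgs-renArgs ts f ι ι′ g sq sp i′ o with occursArgs-renArgs⁻ f ts i′ o
  ... | i , refl , oi = let (j , e) = sp i oi in fun g j , trans (sq j) (cong (fun f) e)

  supported-ren⁻ : ∀ {m n n′} (t : Tm n) (f : Inj n n′) (π : Inj m n) (ι′ : Inj m n′) →
                   ι′ ≈I (f ∘I π) → Supported ι′ (ren f t) → Supported π t
  supported-ren⁻ t f π ι′ sq sp′ i o =
    let (j , e) = sp′ (fun f i) (occurs-ren f t i o) in j , inj f (trans (sym (sq j)) e)

  supportedArgs-renArgs⁻ : ∀ {ks m n n′} (ts : Args ks n) (f : Inj n n′) (π : Inj m n) (ι′ : Inj m n′) →
                           ι′ ≈I (f ∘I π) → SupportedArgs ι′ (renArgs f ts) → SupportedArgs π ts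
  supportedArgs-renArgs⁻ ts f π ι′ sq sp′ i o =
    let (j , e) = sp′ (fun f i) (occursArgs-renArgs f ts i o) in j , inj f (trans (sym (sq j)) e)

  supported-ext^ : ∀ k {m n} (ι : Inj m n) (t : Tm (lift k n)) →
                   (∀ i → Occurs (wk^ k i) t → ∃ λ j → fun ι j ≡ i) → Supported (ext^ k ι) t
  supported-ext^ k ι t h x o = ext^-onto k ι x (λ i e → h i (subst (λ z → Occurs z t) (sym e) o))

  headSupport : ∀ k {m n} (ι : Inj m n) (t : Tm (lift k n)) → Enumeration (λ j → Occurs (wk^ k (fun ι j)) t)
  headSupport k ι t = enumerate _ (λ j → occurs? (wk^ k (fun ι j)) t)

  tailSupport : ∀ {ks m n} (ι : Inj m n) (ts : Args ks n) → Enumeration (λ j → OccursArgs (fun ι j) ts)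
  tailSupport ι ts = enumerate _ (λ j → occursArgs? (fun ι j) ts)

  module _ (k : ℕ) {ks m n} (ι : Inj m n) (t : Tm (lift k n)) (ts : Args ks n) where

    supported-head : SupportedArgs ι (_∷_ {k} t ts) → Supported (ext^ k (ι ∘I embed (headSupport k ι t))) t
    supported-head sp = supported-ext^ k (ι ∘I embed E) t λ i o →
      let (j , e) = sp i (inj₁ o) ; (a , e′) = complete E j (subst (λ z → Occurs (wk^ k z) t) (sym e) o)
      in a , trans (cong (fun ι) e′) e
      where E = headSupport k ι t

    supported-tail : SupportedArgs ι (_∷_ {k} t ts) → SupportedArgs (ι ∘I embed (tailSupport ι ts)) ts
    supported-tail sp i o =
      let (j , e) = sp i (inj₂ o) ; (a , e′) = complete E j (subst (λ z → OccursArgs z ts) (sym e) o)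
      in a , trans (cong (fun ι) e′) e
      where E = tailSupport ι ts

    supports-disjoint : AffineArgs (_∷_ {k} t ts) →
                        ∀ x y → fun (embed (headSupport k ι t)) x ≢ fun (embed (tailSupport ι ts)) y
    supports-disjoint (_ , _ , disjoint) x y e =
      disjoint (fun ι (fun (embed (tailSupport ι ts)) y))
               (subst (λ z → Occurs (wk^ k (fun ι z)) t) e (sound (headSupport k ι t) x))
               (sound (tailSupport ι ts) y)

    supports-copair : .(AffineArgs (_∷_ {k} t ts)) → Inj (size (headSupport k ι t) + size (tailSupport ι ts)) m
    supports-copair a = copairInj (embed (headSupport k ι t)) (embed (tailSupport ι ts)) (supports-disjoint a)

  module Decode (T : Psh) (η : Hom V T) (φ : Hom (SigF S T) T) where

    -- decode t ι reads t, whose free variables lie in the image of ι, in the context m. The proofs are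
    -- irrelevant so that decode depends on t and ι only.
    mutual
      decode : ∀ {m n} (t : Tm n) (ι : Inj m n) → .(Supported ι t) → .(Affine t) → Ob T m
      decode (var i) ι sp a = hom η (pointInj (proj₁ (preimage ι i (sp i refl))))
      decode (op ω ts) ι sp a = hom φ (ω , decodeArgs ts ι sp a)

      decodeArgs : ∀ {ks m n} (ts : Args ks n) (ι : Inj m n) → .(SupportedArgs ι ts) → .(AffineArgs ts) →
                   Ob (SigProd T ks) m
      decodeArgs [] ι sp a = tt
      decodeArgs (_∷_ {k} {[]} t []) ι sp a =
        in^ T k (decode t (ext^ k ι) (supported-ext^ k ι t λ i o → sp i (inj₁ o)) (proj₁ a))
      decodeArgs (_∷_ {k} {_ ∷ _} t ts) ι sp a =
        ⟦ in^ T k (decode t (ext^ k (ι ∘I embed (headSupport k ι t))) (supported-head k ι t ts sp) (proj₁ a)) ,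
          decodeArgs ts (ι ∘I embed (tailSupport ι ts)) (supported-tail k ι t ts sp) (proj₁ (proj₂ a)) ,
          supports-copair k ι t ts a ⟧

    decode-≡ : ∀ {m n} {t t′ : Tm n} (ι : Inj m n) → t ≡ t′ →
               .(sp : Supported ι t) .(a : Affine t) .(sp′ : Supported ι t′) .(a′ : Affine t′) →
               Eq T (decode t ι sp a) (decode t′ ι sp′ a′)
    decode-≡ ι refl _ _ _ _ = ≈refl T

    decodeArgs-≡ : ∀ {ks m n} {ts ts′ : Args ks n} (ι : Inj m n) → ts ≡ ts′ →
                   .(sp : SupportedArgs ι ts) .(a : AffineArgs ts) .(sp′ : SupportedArgs ι ts′) .(a′ : AffineArgs ts′) →
                   Eq (SigProd T ks) (decodeArgs ts ι sp a) (decodeArgs ts′ ι sp′ a′)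
    decodeArgs-≡ {ks} ι refl _ _ _ _ = ≈refl (SigProd T ks)

    mutual
      decode-ren : ∀ {m m′ n n′} (t : Tm n) (f : Inj n n′) (ι : Inj m n) (ι′ : Inj m′ n′) (g : Inj m m′) →
                   (sq : (ι′ ∘I g) ≈I (f ∘I ι)) .(sp : Supported ι t) .(a : Affine t) →
                   Eq T (decode (ren f t) ι′ (supported-ren t f ι ι′ g sq sp) (affine-ren f t a)) (act T g (decode t ι sp a))
      decode-ren (var i) f ι ι′ g sq sp a =
        ≈trans T (hom-cong η {x = pointInj p′} {y = g ∘I pointInj p}
                   λ _ → inj ι′ (trans e′ (sym (trans (sq p) (cong (fun f) e)))))
                 (nat η g (pointInj p))
        where
        p′ = proj₁ (preimage ι′ (fun f i) (supported-ren (var i) f ι ι′ g sq sp (fun f i) refl))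
        e′ = proj₂ (preimage ι′ (fun f i) (supported-ren (var i) f ι ι′ g sq sp (fun f i) refl))
        p = proj₁ (preimage ι i (sp i refl))
        e = proj₂ (preimage ι i (sp i refl))
      decode-ren (op ω ts) f ι ι′ g sq sp a =
        ≈trans T (hom-cong φ (coinj (decodeArgs-renArgs ts f ι ι′ g sq sp a))) (nat φ g (ω , decodeArgs ts ι sp a))

      decodeArgs-renArgs : ∀ {ks m m′ n n′} (ts : Args ks n) (f : Inj n n′) (ι : Inj m n) (ι′ : Inj m′ n′)
                           (g : Inj m m′) →
                           (sq : (ι′ ∘I g) ≈I (f ∘I ι)) .(sp : SupportedArgs ι ts) .(a : AffineArgs ts) →
                           Eq (SigProd T ks)
                              (decodeArgs (renArgs f ts) ι′ (supportedArgs-renArgs ts f ι ι′ g sq sp) (affineArgs-renArgs f ts a))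
                              (act (SigProd T ks) g (decodeArgs ts ι sp a))
      decodeArgs-renArgs [] f ι ι′ g sq sp a = tt
      decodeArgs-renArgs (_∷_ {k} {[]} t []) f ι ι′ g sq sp a =
        ≈trans (δ^ k T)
          (in^-cong T k (decode-ren t (ext^ k f) (ext^ k ι) (ext^ k ι′) (ext^ k g) (ext^-square k sq) _ (proj₁ a)))
          (≈reflexive (δ^ k T) (sym (in^-act T k g _)))
      decodeArgs-renArgs (_∷_ {k} {k′ ∷ ks} t ts) f ι ι′ g sq sp a =
        ≈sym (δ^ k T ⊗̂ SigProd T (k′ ∷ ks)) (day-≈ π₁ π₂ factor stepHead stepTail)
        where
        E₁ = headSupport k ι t
        E₂ = tailSupport ι ts
        E₁′ = headSupport k ι′ (ren (ext^ k f) t)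
        E₂′ = tailSupport ι′ (renArgs f ts)
        lift₁ : ∀ x → ∃ λ y → fun (embed E₁′) y ≡ fun g (fun (embed E₁) x)
        lift₁ x = complete E₁′ _ (subst (λ z → Occurs (wk^ k z) (ren (ext^ k f) t)) (sym (sq (fun (embed E₁) x)))
                                        (occurs-ren-ext^ k f t _ (sound E₁ x)))
        lift₂ : ∀ x → ∃ λ y → fun (embed E₂′) y ≡ fun g (fun (embed E₂) x)
        lift₂ x = complete E₂′ _ (subst (λ z → OccursArgs z (renArgs f ts)) (sym (sq (fun (embed E₂) x)))
                                        (occursArgs-renArgs f ts _ (sound E₂ x)))
        π₁ = factorInj (g ∘I embed E₁) (embed E₁′) lift₁
        π₂ = factorInj (g ∘I embed E₂) (embed E₂′) lift₂
        P = supports-copair k ι t ts a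
        P′ = supports-copair k ι′ (ren (ext^ k f) t) (renArgs f ts) (affineArgs-renArgs f (_∷_ {k} t ts) a)
        factor : (g ∘I P) ≈I (P′ ∘I (π₁ ⊗I π₂))
        factor = ⊗-factor (g ∘I P) P′ π₁ π₂
          (λ x → trans (lookup-++ˡ (fun (embed E₁′)) (fun (embed E₂′)) (fun π₁ x))
                       (trans (proj₂ (lift₁ x)) (sym (cong (fun g) (lookup-++ˡ (fun (embed E₁)) (fun (embed E₂)) x)))))
          (λ y → trans (lookup-++ʳ (fun (embed E₁′)) (fun (embed E₂′)) (fun π₂ y))
                       (trans (proj₂ (lift₂ y)) (sym (cong (fun g) (lookup-++ʳ (fun (embed E₁)) (fun (embed E₂)) y)))))
        A = in^ T k (decode t (ext^ k (ι ∘I embed E₁)) (supported-head k ι t ts sp) (proj₁ a))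
        A′ = in^ T k (decode (ren (ext^ k f) t) (ext^ k (ι′ ∘I embed E₁′)) _ _)
        stepHead : Eq (δ^ k T) (act (δ^ k T) π₁ A) A′
        stepHead = ≈trans (δ^ k T) (≈reflexive (δ^ k T) (in^-act T k π₁ _))
          (in^-cong T k (≈sym T (decode-ren t (ext^ k f) (ext^ k (ι ∘I embed E₁)) (ext^ k (ι′ ∘I embed E₁′)) (ext^ k π₁)
            (ext^-square k λ x → trans (cong (fun ι′) (proj₂ (lift₁ x))) (sq (fun (embed E₁) x)))
            (supported-head k ι t ts sp) (proj₁ a))))
        stepTail : Eq (SigProd T (k′ ∷ ks)) (act (SigProd T (k′ ∷ ks)) π₂ (decodeArgs ts (ι ∘I embed E₂) _ (proj₁ (proj₂ a))))
                                            (decodeArgs (renArgs f ts) (ι′ ∘I embed E₂′) _ _)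
        stepTail = ≈sym (SigProd T (k′ ∷ ks)) (decodeArgs-renArgs ts f (ι ∘I embed E₂) (ι′ ∘I embed E₂′) π₂
          (λ x → trans (cong (fun ι′) (proj₂ (lift₂ x))) (sq (fun (embed E₂) x)))
          (supported-tail k ι t ts sp) (proj₁ (proj₂ a)))

    decode-reindex : ∀ {m m′ n} (t : Tm n) (ι : Inj m n) (ι′ : Inj m′ n) (g : Inj m m′) → (ι′ ∘I g) ≈I ι →
                     .(sp : Supported ι t) .(a : Affine t) .(sp′ : Supported ι′ t) →
                     Eq T (decode t ι′ sp′ a) (act T g (decode t ι sp a))
    decode-reindex t ι ι′ g sq sp a sp′ =
      ≈trans T (decode-≡ ι′ (sym (ren-id t)) sp′ a _ _) (decode-ren t idI ι ι′ g sq sp a)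

    decodeArgs-reindex : ∀ {ks m m′ n} (ts : Args ks n) (ι : Inj m n) (ι′ : Inj m′ n) (g : Inj m m′) →
                         (ι′ ∘I g) ≈I ι →
                         .(sp : SupportedArgs ι ts) .(a : AffineArgs ts) .(sp′ : SupportedArgs ι′ ts) →
                         Eq (SigProd T ks) (decodeArgs ts ι′ sp′ a) (act (SigProd T ks) g (decodeArgs ts ι sp a))
    decodeArgs-reindex {ks} ts ι ι′ g sq sp a sp′ =
      ≈trans (SigProd T ks) (decodeArgs-≡ ι′ (sym (renArgs-id ts)) sp′ a _ _) (decodeArgs-renArgs ts idI ι ι′ g sq sp a)

    decode-unren : ∀ {m n n′} (t : Tm n) (f : Inj n n′) (π : Inj m n) (ι′ : Inj m n′) → (sq : ι′ ≈I (f ∘I π)) →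
                   .(sp′ : Supported ι′ (ren f t)) .(a : Affine t) →
                   Eq T (act T π (decode (ren f t) ι′ sp′ (affine-ren f t a))) (decode t idI (supported-id t) a)
    decode-unren t f π ι′ sq sp′ a = ≈trans T
      (act-cong T (λ _ → refl) (≈trans T (decode-ren t f π ι′ idI sq (supported-ren⁻ t f π ι′ sq sp′) a) (act-id T _)))
      (≈sym T (decode-reindex t π idI π (λ _ → refl) (supported-ren⁻ t f π ι′ sq sp′) a (supported-id t)))

    decodeArgs-unren : ∀ {ks m n n′} (ts : Args ks n) (f : Inj n n′) (π : Inj m n) (ι′ : Inj m n′) →
                       (sq : ι′ ≈I (f ∘I π)) →
                       .(sp′ : SupportedArgs ι′ (renArgs f ts)) .(a : AffineArgs ts) →
                       Eq (SigProd T ks) (act (SigProd T ks) π (decodeArgs (renArgs f ts) ι′ sp′ (affineArgs-renArgs f ts a)))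
                                         (decodeArgs ts idI (supportedArgs-id ts) a)
    decodeArgs-unren {ks} ts f π ι′ sq sp′ a = ≈trans (SigProd T ks)
      (act-cong (SigProd T ks) (λ _ → refl)
        (≈trans (SigProd T ks) (decodeArgs-renArgs ts f π ι′ idI sq (supportedArgs-renArgs⁻ ts f π ι′ sq sp′) a)
                               (act-id (SigProd T ks) _)))
      (≈sym (SigProd T ks)
        (decodeArgs-reindex ts π idI π (λ _ → refl) (supportedArgs-renArgs⁻ ts f π ι′ sq sp′) a (supportedArgs-id ts)))

    decodeTm : Fun AffTm T
    decodeTm (t , a) = decode t idI (supported-id t) a

    decodeTm-in^ : ∀ k {n} (x : Ob (δ^ k AffTm) n) →
                   Eq (δ^ k T) (in^ T k (decodeTm (out^ AffTm k x))) (δ^map k decodeTm x)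
    decodeTm-in^ k x = ≈reflexive (δ^ k T)
      (trans (cong (in^ T k) (sym (out^-δ^map k decodeTm x))) (in^-out^ T k _))

    decode-flatten : ∀ ks {m} (D : Ob (SigProd AffTm ks) m) →
                     Eq (SigProd T ks) (decodeArgs (flattenArgs ks D) idI (supportedArgs-id _) (proj₂ (flatten ks D)))
                                       (sigProdMap ks decodeTm D)
    decode-flatten [] D = tt
    decode-flatten (k ∷ []) x = ≈trans (δ^ k T)
      (in^-cong T k (≈trans T (decode-reindex t idI (ext^ k idI) idI (ext^-id k) (supported-id t) a _) (act-id T _)))
      (decodeTm-in^ k x)
      where
      t = proj₁ (out^ AffTm k x)
      a = proj₂ (out^ AffTm k x)
    decode-flatten (k ∷ k′ ∷ ks) (⟦_,_,_⟧ {m₁} {m₂} x y j) = day-≈ π₁ π₂ factor stepHead stepTail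
      where
      t = proj₁ (out^ AffTm k x)
      ts = flattenArgs (k′ ∷ ks) y
      jL = j ∘I inclL m₂
      jR = j ∘I inclR m₁
      E₁ = headSupport k idI (ren (ext^ k jL) t)
      E₂ = tailSupport idI (renArgs jR ts)
      restrict₁ : ∀ x → ∃ λ y → fun jL y ≡ fun (embed E₁) x
      restrict₁ x with occurs-ren⁻ (ext^ k jL) t _ (sound E₁ x)
      ... | z , e , _ with ext^-inv k jL (fun (embed E₁) x) z e
      ... | y , _ , e′ = y , e′
      restrict₂ : ∀ x → ∃ λ y → fun jR y ≡ fun (embed E₂) x
      restrict₂ x with occursArgs-renArgs⁻ jR ts _ (sound E₂ x)
      ... | y , e , _ = y , e
      π₁ = factorInj (embed E₁) jL restrict₁
      π₂ = factorInj (embed E₂) jR restrict₂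
      P = supports-copair k idI (ren (ext^ k jL) t) (renArgs jR ts) (proj₂ (flatten (k ∷ k′ ∷ ks) ⟦ x , y , j ⟧))
      factor : P ≈I (j ∘I (π₁ ⊗I π₂))
      factor = ⊗-factor P j π₁ π₂
        (λ x → trans (proj₂ (restrict₁ x)) (sym (lookup-++ˡ (fun (embed E₁)) (fun (embed E₂)) x)))
        (λ y → trans (proj₂ (restrict₂ y)) (sym (lookup-++ʳ (fun (embed E₁)) (fun (embed E₂)) y)))
      stepHead : Eq (δ^ k T) (act (δ^ k T) π₁ (in^ T k (decode (ren (ext^ k jL) t) (ext^ k (idI ∘I embed E₁)) _ _)))
                             (δ^map k decodeTm x)
      stepHead = ≈trans (δ^ k T) (≈reflexive (δ^ k T) (in^-act T k π₁ _))
        (≈trans (δ^ k T) (in^-cong T k (decode-unren t (ext^ k jL) (ext^ k π₁) (ext^ k (idI ∘I embed E₁))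
                   (λ i → trans (ext^-cong k (λ x → sym (proj₂ (restrict₁ x))) i) (ext^-∘ k jL π₁ i)) _ _))
          (decodeTm-in^ k x))
      stepTail : Eq (SigProd T (k′ ∷ ks)) (act (SigProd T (k′ ∷ ks)) π₂ (decodeArgs (renArgs jR ts) (idI ∘I embed E₂) _ _))
                                          (sigProdMap (k′ ∷ ks) decodeTm y)
      stepTail = ≈trans (SigProd T (k′ ∷ ks))
        (decodeArgs-unren ts jR π₂ (idI ∘I embed E₂) (λ x → sym (proj₂ (restrict₂ x))) _ _)
        (decode-flatten (k′ ∷ ks) y)

    decodeHom : Hom AffTm T
    decodeHom = record
      { hom = decodeTm
      ; hom-cong = λ {_} {t} {u} p → decode-≡ idI p (supported-id (proj₁ t)) (proj₂ t) (supported-id (proj₁ u)) (proj₂ u)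
      ; nat = λ f t → decode-ren (proj₁ t) f idI idI f (λ _ → refl) (supported-id (proj₁ t)) (proj₂ t)
      }

    decodeTm-cong : ∀ {n} (t u : Ob AffTm n) → proj₁ t ≡ proj₁ u → Eq T (decodeTm t) (decodeTm u)
    decodeTm-cong t u = hom-cong decodeHom {x = t} {y = u}

    -- T is isomorphic to the affine terms

    module Initial (init : IsInitialAlg S T η φ) where

      encodeHom : Hom T AffTm
      encodeHom = proj₁ (init AffTm varAlg opAlg)

      encode : Fun T AffTm
      encode = hom encodeHom

      ⌊_⌋ : ∀ {n} → Ob T n → Tm n
      ⌊ x ⌋ = proj₁ (encode x)

      ⌊η⌋ : ∀ {n} (v : Ob V n) → ⌊ hom η v ⌋ ≡ var (fun v zero)
      ⌊η⌋ = proj₁ (proj₁ (proj₂ (init AffTm varAlg opAlg)))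

      ⌊φ⌋ : ∀ {n} ω (D : Ob (SigProd T (ar S ω)) n) →
            ⌊ hom φ (ω , D) ⌋ ≡ op ω (flattenArgs (ar S ω) (sigProdMap (ar S ω) encode D))
      ⌊φ⌋ ω D = proj₂ (proj₁ (proj₂ (init AffTm varAlg opAlg))) (ω , D)

      ⌊act⌋ : ∀ {m n} (f : Inj m n) (x : Ob T m) → ⌊ act T f x ⌋ ≡ ren f ⌊ x ⌋
      ⌊act⌋ = nat encodeHom

      ⌊in^⌋ : ∀ k {n} (x : Ob T (lift k n)) → proj₁ (out^ AffTm k (δ^map k encode (in^ T k x))) ≡ ⌊ x ⌋
      ⌊in^⌋ k x = cong proj₁ (trans (out^-δ^map k encode (in^ T k x)) (cong encode (out^-in^ T k x)))

      mutual
        ren-⌊decode⌋ : ∀ {m n} (t : Tm n) (ι : Inj m n) .(sp : Supported ι t) .(a : Affine t) →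
                       ren ι ⌊ decode t ι sp a ⌋ ≡ t
        ren-⌊decode⌋ (var i) ι sp a = trans (cong (ren ι) (⌊η⌋ (pointInj (proj₁ (preimage ι i (sp i refl))))))
                                            (cong var (proj₂ (preimage ι i (sp i refl))))
        ren-⌊decode⌋ (op ω ts) ι sp a =
          trans (cong (ren ι) (⌊φ⌋ ω (decodeArgs ts ι sp a))) (cong (op ω) (renArgs-⌊decodeArgs⌋ ts ι sp a))

        renArgs-⌊decodeArgs⌋ : ∀ {ks m n} (ts : Args ks n) (ι : Inj m n) .(sp : SupportedArgs ι ts) .(a : AffineArgs ts) →
                               renArgs ι (flattenArgs ks (sigProdMap ks encode (decodeArgs ts ι sp a))) ≡ ts
        renArgs-⌊decodeArgs⌋ [] ι sp a = refl
        renArgs-⌊decodeArgs⌋ (_∷_ {k} {[]} t []) ι sp a =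
          cong (_∷ []) (trans (cong (ren (ext^ k ι)) (⌊in^⌋ k _)) (ren-⌊decode⌋ t (ext^ k ι) _ (proj₁ a)))
        renArgs-⌊decodeArgs⌋ (_∷_ {k} {_ ∷ _} t ts) ι sp a = cong₂ _∷_
          (begin
            ren (ext^ k ι) (ren (ext^ k (P ∘I inclL _)) (proj₁ (out^ AffTm k (δ^map k encode (in^ T k A)))))
              ≡⟨ ren-ext^-∘ k ι (P ∘I inclL _) _ ⟩
            ren (ext^ k (ι ∘I P ∘I inclL _)) (proj₁ (out^ AffTm k (δ^map k encode (in^ T k A))))
              ≡⟨ ren-cong (ext^-cong k λ x → cong (fun ι) (lookup-++ˡ (fun (embed E₁)) (fun (embed E₂)) x)) _ ⟩
            ren (ext^ k (ι ∘I embed E₁)) (proj₁ (out^ AffTm k (δ^map k encode (in^ T k A))))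
              ≡⟨ cong (ren (ext^ k (ι ∘I embed E₁))) (⌊in^⌋ k A) ⟩
            ren (ext^ k (ι ∘I embed E₁)) ⌊ A ⌋
              ≡⟨ ren-⌊decode⌋ t (ext^ k (ι ∘I embed E₁)) (supported-head k ι t ts sp) (proj₁ a) ⟩
            t ∎)
          (trans (sym (renArgs-∘ ι (P ∘I inclR _) _))
            (trans (renArgs-cong (λ y → cong (fun ι) (lookup-++ʳ (fun (embed E₁)) (fun (embed E₂)) y)) _)
              (renArgs-⌊decodeArgs⌋ ts (ι ∘I embed E₂) (supported-tail k ι t ts sp) (proj₁ (proj₂ a)))))
          where
          open ≡-Reasoning
          E₁ = headSupport k ι t
          E₂ = tailSupport ι ts
          P = supports-copair k ι t ts a
          A = decode t (ext^ k (ι ∘I embed E₁)) (supported-head k ι t ts sp) (proj₁ a)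

      ⌊decodeTm⌋ : ∀ {n} (t : Ob AffTm n) → ⌊ decodeTm t ⌋ ≡ proj₁ t
      ⌊decodeTm⌋ (t , a) = trans (sym (ren-id _)) (ren-⌊decode⌋ t idI (supported-id t) a)

      decode∘encode : Hom T T
      decode∘encode = decodeHom ∘H encodeHom

      idH-isAlgHom : IsAlgHom S T η φ T η φ idH
      idH-isAlgHom = (λ v → ≈refl T)
                   , (λ { (ω , D) → hom-cong φ (coinj (≈sym (SigProd T (ar S ω)) (sigProdMap-id (ar S ω) D))) })

      decode∘encode-isAlgHom : IsAlgHom S T η φ T η φ decode∘encode
      decode∘encode-isAlgHom = onVar , onOp
        where
        onVar : ∀ {n} (v : Ob V n) → Eq T (decodeTm (encode (hom η v))) (hom η v)
        onVar v = ≈trans T (decodeTm-cong (encode (hom η v)) (hom varAlg v) (⌊η⌋ v))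
                           (hom-cong η λ z → trans (proj₂ (preimage idI (fun v zero) _)) (cong (fun v) (Fin1-≡ zero z)))
        onOp : ∀ {n} (D : Ob (SigF S T) n) → Eq T (decodeTm (encode (hom φ D))) (hom φ (sigMap S (hom decode∘encode) D))
        onOp (ω , D) = ≈trans T (decodeTm-cong (encode (hom φ (ω , D))) (hom opAlg (sigMap S encode (ω , D))) (⌊φ⌋ ω D))
          (≈trans T (hom-cong φ (coinj (decode-flatten (ar S ω) (sigProdMap (ar S ω) encode D))))
            (≈reflexive T (cong (λ E → hom φ (ω , E)) (sym (sigProdMap-∘ (ar S ω) decodeTm encode D)))))

      decode-encode : ∀ {n} (x : Ob T n) → Eq T (decodeTm (encode x)) x
      decode-encode x = ≈trans T (unique decode∘encode decode∘encode-isAlgHom x) (≈sym T (unique idH idH-isAlgHom x))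
        where unique = proj₂ (proj₂ (init T η φ))

      decodeTm-⌊⌋ : ∀ {n} (t : Ob AffTm n) (x : Ob T n) → proj₁ t ≡ ⌊ x ⌋ → Eq T (decodeTm t) x
      decodeTm-⌊⌋ t x e = ≈trans T (decodeTm-cong t (encode x) e) (decode-encode x)

      σT : Hom (δ T ⊗̂ T) T
      σT = decodeHom ∘H substAlg ∘H dayHom (δHom encodeHom) encodeHom

      ⌊σT⌋ : ∀ {m₁ m₂ n} (x : Ob (δ T) m₁) (y : Ob T m₂) (K : Inj (m₁ + m₂) n) →
             ⌊ hom σT ⟦ x , y , K ⟧ ⌋ ≡ sub (plug K ⌊ y ⌋) ⌊ x ⌋
      ⌊σT⌋ x y K = ⌊decodeTm⌋ (substTm ⟦ encode x , encode y , K ⟧)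

      σT-≡ : ∀ {n} (d d′ : DayEl (δ T) T n) →
             proj₁ (substTm (dayMap encode encode d)) ≡ proj₁ (substTm (dayMap encode encode d′)) →
             Eq T (hom σT d) (hom σT d′)
      σT-≡ d d′ = decodeTm-cong (substTm (dayMap encode encode d)) (substTm (dayMap encode encode d′))

      σT-⌊⌋ : ∀ {n} (d : DayEl (δ T) T n) {x : Ob T n} →
              proj₁ (substTm (dayMap encode encode d)) ≡ ⌊ x ⌋ → Eq T (hom σT d) x
      σT-⌊⌋ d = decodeTm-⌊⌋ (substTm (dayMap encode encode d)) _

      open ≡-Reasoning

      νT : Hom One (δ T)
      νT = lastVariable η

      σT-unitˡ : ∀ {n} (e : Ob (One ⊗̂ T) n) →
             Eq T (hom σT (dayMap {One} {δ T} {T} {T} (hom νT) (idF T) e)) (unitL T e)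
      σT-unitˡ (⟦_,_,_⟧ {m₁} _ x k) = σT-⌊⌋ ⟦ hom νT tt , x , k ⟧ (begin
        sub (plug k ⌊ x ⌋) ⌊ hom η (inclR m₁) ⌋  ≡⟨ cong (sub (plug k ⌊ x ⌋)) (⌊η⌋ (inclR m₁)) ⟩
        plug k ⌊ x ⌋ (m₁ ↑ʳ zero)                ≡⟨ plug-↑ʳ k ⌊ x ⌋ zero ⟩
        ren (k ∘I inclR m₁) ⌊ x ⌋                ≡⟨ sym (⌊act⌋ (k ∘I inclR m₁) x) ⟩
        ⌊ act T (k ∘I inclR m₁) x ⌋              ∎)

      σT-unitʳ : ∀ {n} (e : Ob (δ T ⊗̂ One) n) →
             Eq (δ T) (δmap {δ T ⊗̂ T} {T} (hom σT)
                         (strL (δ T) T (dayMap {δ T} {δ T} {One} {δ T} (idF (δ T)) (hom νT) e)))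
                      (unitR (δ T) e)
      σT-unitʳ (⟦_,_,_⟧ {m₁} {m₂} x _ k) = σT-⌊⌋ ⟦ x , hom νT tt , strLInj {m₁} {m₂} k ⟧ (begin
        sub (plug {m₁} (strLInj {m₁} {m₂} k) ⌊ hom η (inclR m₂) ⌋) ⌊ x ⌋
          ≡⟨ cong (λ u → sub (plug {m₁} (strLInj {m₁} {m₂} k) u) ⌊ x ⌋) (⌊η⌋ (inclR m₂)) ⟩
        sub (plug {m₁} (strLInj {m₁} {m₂} k) (var (m₂ ↑ʳ zero))) ⌊ x ⌋
          ≡⟨ sub-cong (plug-strL-last {m₁} {m₂} k) ⌊ x ⌋ ⟩
        sub (λ i → var (fun (ext (k ∘I inclL m₂)) i)) ⌊ x ⌋
          ≡⟨ sub-var (ext (k ∘I inclL m₂)) ⌊ x ⌋ ⟩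
        ren (ext (k ∘I inclL m₂)) ⌊ x ⌋
          ≡⟨ sym (⌊act⌋ (ext (k ∘I inclL m₂)) x) ⟩
        ⌊ act (δ T) (k ∘I inclL m₂) x ⌋ ∎)

      σT-assoc : ∀ {n} (e : Ob (δ T ⊗̂ (δ T ⊗̂ T)) n) →
             Eq T (hom σT (dayMap {δ T} {δ T} {δ T ⊗̂ T} {T} (idF (δ T)) (hom σT) e))
                  (hom σT (dayMap {δ (δ T ⊗̂ T)} {δ T} {T} {T} (δmap {δ T ⊗̂ T} {T} (hom σT)) (idF T)
                    (dayMap {δ T ⊗̂ δ T} {δ (δ T ⊗̂ T)} {T} {T} (strL (δ T) T) (idF T)
                      (assocL (δ T) (δ T) T e))))
      σT-assoc (⟦_,_,_⟧ {m₁} {m₂} x (⟦_,_,_⟧ {p₁} {p₂} y z f) g) =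
        σT-≡ ⟦ x , hom σT ⟦ y , z , f ⟧ , g ⟧ ⟦ hom σT ⟦ x , y , K ⟧ , z , G ⟧ (begin
        sub (plug g ⌊ hom σT ⟦ y , z , f ⟧ ⌋) ⌊ x ⌋           ≡⟨ cong (λ u → sub (plug g u) ⌊ x ⌋) (⌊σT⌋ y z f) ⟩
        sub (plug g (sub (plug f ⌊ z ⌋) ⌊ y ⌋)) ⌊ x ⌋         ≡⟨ sub-cong (λ i → sym (plug-assoc g f ⌊ y ⌋ ⌊ z ⌋ i)) ⌊ x ⌋ ⟩
        sub (λ i → sub (plug G ⌊ z ⌋) (plug K ⌊ y ⌋ i)) ⌊ x ⌋ ≡⟨ sym (sub-sub (plug G ⌊ z ⌋) (plug K ⌊ y ⌋) ⌊ x ⌋) ⟩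
        sub (plug G ⌊ z ⌋) (sub (plug K ⌊ y ⌋) ⌊ x ⌋)         ≡⟨ cong (sub (plug G ⌊ z ⌋)) (sym (⌊σT⌋ x y K)) ⟩
        sub (plug G ⌊ z ⌋) ⌊ hom σT ⟦ x , y , K ⟧ ⌋           ∎)
        where
        G = assocInj {m₁} {m₂} {p₁} {p₂} g f
        K = strLInj {m₁} {p₁} idI

      σT-exchange : ∀ {n} (e : Ob (δ (δ T) ⊗̂ (T ⊗̂ T)) n) →
             let L : Fun ((δ (δ T) ⊗̂ T) ⊗̂ T) T
                 L = λ t → hom σT (dayMap {δ (δ T ⊗̂ T)} {δ T} {T} {T} (δmap {δ T ⊗̂ T} {T} (hom σT)) (idF T)
                              (dayMap {δ (δ T) ⊗̂ T} {δ (δ T ⊗̂ T)} {T} {T} (strR (δ T) T) (idF T) t))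
             in Eq T (L (assocL (δ (δ T)) T T e))
                     (L (assocL (δ (δ T)) T T
                          (dayMap {δ (δ T)} {δ (δ T)} {T ⊗̂ T} {T ⊗̂ T} (idF (δ (δ T))) (gamma T T)
                            (dayMap {δ (δ T)} {δ (δ T)} {T ⊗̂ T} {T ⊗̂ T} (swapδ T) (idF (T ⊗̂ T)) e))))
      σT-exchange (⟦_,_,_⟧ {m₁} {m₂} x (⟦_,_,_⟧ {p₁} {p₂} y z f) g) =
        σT-≡ ⟦ hom σT ⟦ x , y , K₁ ⟧ , z , G₀ ⟧ ⟦ hom σT ⟦ swapδ T x , z , K₂ ⟧ , y , G₁ ⟧ (begin
        sub ρ₀ ⌊ hom σT ⟦ x , y , K₁ ⟧ ⌋                  ≡⟨ cong (sub ρ₀) (⌊σT⌋ x y K₁) ⟩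
        sub ρ₀ (sub σ₁ ⌊ x ⌋)                             ≡⟨ sub-sub ρ₀ σ₁ ⌊ x ⌋ ⟩
        sub (λ i → sub ρ₀ (σ₁ i)) ⌊ x ⌋                   ≡⟨ sub-cong (plug-exchange g f ⌊ y ⌋ ⌊ z ⌋) ⌊ x ⌋ ⟩
        sub (λ i → sub ρ₁ (σ₂ (fun swapInj i))) ⌊ x ⌋     ≡⟨ sym (sub-ren (λ i → sub ρ₁ (σ₂ i)) swapInj ⌊ x ⌋) ⟩
        sub (λ i → sub ρ₁ (σ₂ i)) (ren swapInj ⌊ x ⌋)     ≡⟨ sym (sub-sub ρ₁ σ₂ (ren swapInj ⌊ x ⌋)) ⟩
        sub ρ₁ (sub σ₂ (ren swapInj ⌊ x ⌋))               ≡⟨ cong (sub ρ₁ ∘ sub σ₂) (sym (⌊act⌋ swapInj x)) ⟩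
        sub ρ₁ (sub σ₂ ⌊ swapδ T x ⌋)                     ≡⟨ cong (sub ρ₁) (sym (⌊σT⌋ (swapδ T x) z K₂)) ⟩
        sub ρ₁ ⌊ hom σT ⟦ swapδ T x , z , K₂ ⟧ ⌋          ∎)
        where
        K₁ = strRInj {m₁} {p₁} idI
        K₂ = strRInj {m₁} {p₂} idI
        G₀ = assocInj {m₁} {m₂} {p₁} {p₂} g f
        G₁ = assocInj {m₁} {m₂} {p₂} {p₁} g (f ∘I blockSwap p₂ p₁)
        ρ₀ = plug {m₁ + p₁} G₀ ⌊ z ⌋
        ρ₁ = plug {m₁ + p₂} G₁ ⌊ y ⌋
        σ₁ = plug {m₁ + 1} K₁ ⌊ y ⌋
        σ₂ = plug {m₁ + 1} K₂ ⌊ z ⌋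

      σT-up : ∀ {n} (e : Ob (T ⊗̂ T) n) →
             Eq T (hom σT (dayMap {T} {δ T} {T} {T} (up T) (idF T) e)) (proj1 T T e)
      σT-up (⟦_,_,_⟧ {m₁} {m₂} x y k) = σT-⌊⌋ ⟦ up T x , y , k ⟧ (begin
        sub (plug k ⌊ y ⌋) ⌊ up T x ⌋                 ≡⟨ cong (sub (plug k ⌊ y ⌋)) (⌊act⌋ upInj x) ⟩
        sub (plug k ⌊ y ⌋) (ren upInj ⌊ x ⌋)          ≡⟨ sub-ren (plug k ⌊ y ⌋) upInj ⌊ x ⌋ ⟩
        sub (λ a → plug k ⌊ y ⌋ (fun upInj a)) ⌊ x ⌋  ≡⟨ sub-cong (plug-up k ⌊ y ⌋) ⌊ x ⌋ ⟩
        sub (λ a → var (fun (k ∘I inclL m₂) a)) ⌊ x ⌋ ≡⟨ sub-var (k ∘I inclL m₂) ⌊ x ⌋ ⟩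
        ren (k ∘I inclL m₂) ⌊ x ⌋                     ≡⟨ sym (⌊act⌋ (k ∘I inclL m₂) x) ⟩
        ⌊ act T (k ∘I inclL m₂) x ⌋                   ∎)

      isAffineSubstAlg : IsAffineSubstAlg T σT νT
      isAffineSubstAlg = record
        { ax-a = σT-unitˡ ; ax-b = σT-unitʳ ; ax-c = σT-assoc ; ax-d = σT-exchange ; ax-e = σT-up }

mainTheorem9 : (S : BindingSignature) (T : Psh) (η : Hom V T) (φ : Hom (SigF S T) T) →
    IsInitialAlg S T η φ →
    Σ (Hom (δ T ⊗̂ T) T) λ σ → Σ (Hom One (δ T)) λ ν → IsAffineSubstAlg T σ ν
mainTheorem9 S T η φ init = σT , νT , isAffineSubstAlg
  where open Syntax.Decode.Initial S T η φ init
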